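{- For MALL proofs $\pi$ and $\tau$, if $\pi\equiv_1\tau$ (one step of rule commutation) then $\pi=_\beta\tau$.
   Context: MALL proofs are one-sided sequent calculus derivations with rules $ax$, exchange, $cut$, $\otimes$, $⅋$, $1$, $\bot$, $\&$, $\oplus_1$, $\oplus_2$, $\top$. $=_\beta$ is the equivalence generated by standard cut-elimination steps (key cases $ax$, $\otimes/⅋$, $\&/\oplus_i$, $1/\bot$ and commutative cases of a cut with $⅋,\otimes,\&,\oplus_i,\bot,\top,cut$ rules). Rule commutation $\equiv_1$ is the symmetric relation relating two proofs that differ only by exchanging the order of two consecutive non-$ax$, non-$cut$ logical rules $r$ (above) and $s$ (below) where $s$ does not act on the formula introduced by $r$, following the standard MALL permutation table: when one of the rules is a $\&$-rule the other rule (with any side premise of a $\otimes$-rule) appears duplicated in both premises of the $\&$; when one of the rules is a $\top$-rule, commuting it down erases the other rule and its side sub-proof (and conversely creates one); also two $\top$-rules may swap which $\top$ occurrence is principal, and two consecutive $\bot$-rules may be swapped. The commutation is only allowed when there is no $cut$-rule in the sub-proofs above the commuted rules (including erased, created or duplicated sub-proofs); cuts may occur below. -}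

module Defs where

-- MALL proofs as explicitly annotated, named proof terms (CP-style), with
-- a separate typing judgment.

open import Data.Nat using (ℕ; _≟_)
open import Data.Product using (_×_; _,_; proj₁; Σ)
open import Data.Sum using (_⊎_)
open import Data.Unit using (⊤)
open import Data.Empty using (⊥)
open import Data.Bool using (if_then_else_)
open import Data.List using (List; []; _∷_; _++_; map; filter)
open import Data.List.Membership.Propositional using (_∈_; _∉_)
open import Data.List.Relation.Binary.Permutation.Propositional using (_↭_)
open import Data.List.Relation.Binary.Disjoint.Propositional using (Disjoint)
open import Data.List.Relation.Unary.Unique.Propositional using (Unique)
open import Relation.Nullary using (does; ¬?)
open import Relation.Binary.PropositionalEquality using (_≢_)

data Formula : Set where
  atom atom⊥ : ℕ → Formula
  𝟏 ⊥ᶠ 𝟎 ⊤ᶠ : Formula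
  _⊗_ _⅋_ _&_ _⊕_ : Formula → Formula → Formula

dual : Formula → Formula
dual (atom n)  = atom⊥ n
dual (atom⊥ n) = atom n
dual 𝟏 = ⊥ᶠ
dual ⊥ᶠ = 𝟏
dual 𝟎 = ⊤ᶠ
dual ⊤ᶠ = 𝟎
dual (A ⊗ B) = dual A ⅋ dual B
dual (A ⅋ B) = dual A ⊗ dual B
dual (A & B) = dual A ⊕ dual B
dual (A ⊕ B) = dual A & dual B

-- Sequents: formula occurrences labelled by (distinct) names.
-- Exchange is implicit: typing is closed under permutation of the list.

Name : Set
Name = ℕ

Sequent : Set
Sequent = List (Name × Formula)

names : Sequent → List Name
names = map proj₁

data Term : Set where
  ax    : Formula → Name → Name → Term
  cut   : Formula → Name → Term → Term → Term
  tens  : Name → Name → Term → Term → Term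
  par   : Name → Name → Term → Term
  one   : Name → Term
  bot   : Name → Term → Term
  wth   : Name → Term → Term → Term
  plus₁ : Name → Formula → Term → Term
  plus₂ : Name → Formula → Term → Term
  top   : Name → Sequent → Term

infix 4 _⊢_

data _⊢_ : Term → Sequent → Set where
  ⊢ex    : ∀ {P Γ Δ} → Γ ↭ Δ → P ⊢ Γ → P ⊢ Δ
  ⊢ax    : ∀ {A x y} → x ≢ y → ax A x y ⊢ (x , dual A) ∷ (y , A) ∷ []
  ⊢cut   : ∀ {A x P Q Γ Δ} → P ⊢ (x , A) ∷ Γ → Q ⊢ (x , dual A) ∷ Δ →
           Unique (names (Γ ++ Δ)) → cut A x P Q ⊢ Γ ++ Δ
  ⊢tens  : ∀ {A B x y P Q Γ Δ} → P ⊢ (y , A) ∷ Γ → Q ⊢ (x , B) ∷ Δ →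
           Unique (names ((x , A ⊗ B) ∷ Γ ++ Δ)) → tens x y P Q ⊢ (x , A ⊗ B) ∷ Γ ++ Δ
  ⊢par   : ∀ {A B x y P Γ} → P ⊢ (y , A) ∷ (x , B) ∷ Γ → par x y P ⊢ (x , A ⅋ B) ∷ Γ
  ⊢one   : ∀ {x} → one x ⊢ (x , 𝟏) ∷ []
  ⊢bot   : ∀ {x P Γ} → P ⊢ Γ → x ∉ names Γ → bot x P ⊢ (x , ⊥ᶠ) ∷ Γ
  ⊢wth   : ∀ {A B x P Q Γ} → P ⊢ (x , A) ∷ Γ → Q ⊢ (x , B) ∷ Γ → wth x P Q ⊢ (x , A & B) ∷ Γ
  ⊢plus₁ : ∀ {A B x P Γ} → P ⊢ (x , A) ∷ Γ → plus₁ x B P ⊢ (x , A ⊕ B) ∷ Γ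
  ⊢plus₂ : ∀ {A B x P Γ} → P ⊢ (x , B) ∷ Γ → plus₂ x A P ⊢ (x , A ⊕ B) ∷ Γ
  ⊢top   : ∀ {x Γ} → Unique (names ((x , ⊤ᶠ) ∷ Γ)) → top x Γ ⊢ (x , ⊤ᶠ) ∷ Γ

rm : Name → List Name → List Name
rm x = filter (λ y → ¬? (y ≟ x))

fv : Term → List Name
fv (ax A x y)     = x ∷ y ∷ []
fv (cut A x P Q)  = rm x (fv P ++ fv Q)
fv (tens x y P Q) = x ∷ (rm y (fv P) ++ rm x (fv Q))
fv (par x y P)    = x ∷ rm y (rm x (fv P))
fv (one x)        = x ∷ []
fv (bot x P)      = x ∷ fv P
fv (wth x P Q)    = x ∷ rm x (fv P ++ fv Q)
fv (plus₁ x B P)  = x ∷ rm x (fv P)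
fv (plus₂ x A P)  = x ∷ rm x (fv P)
fv (top x Γ)      = x ∷ names Γ

allNames : Term → List Name
allNames (ax A x y)     = x ∷ y ∷ []
allNames (cut A x P Q)  = x ∷ allNames P ++ allNames Q
allNames (tens x y P Q) = x ∷ y ∷ allNames P ++ allNames Q
allNames (par x y P)    = x ∷ y ∷ allNames P
allNames (one x)        = x ∷ []
allNames (bot x P)      = x ∷ allNames P
allNames (wth x P Q)    = x ∷ allNames P ++ allNames Q
allNames (plus₁ x B P)  = x ∷ allNames P
allNames (plus₂ x A P)  = x ∷ allNames P
allNames (top x Γ)      = x ∷ names Γ

rn : Name → Name → Name → Name
rn x x' z = if does (z ≟ x) then x' else z

-- ren x x' P : rename the free occurrences of x into x' (no capture
-- avoidance; only used under freshness side conditions)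
ren : Name → Name → Term → Term
ren x x' (ax A a b)     = ax A (rn x x' a) (rn x x' b)
ren x x' (cut A y P Q)  = if does (y ≟ x) then cut A y P Q else cut A y (ren x x' P) (ren x x' Q)
ren x x' (tens z y P Q) = tens (rn x x' z) y (if does (y ≟ x) then P else ren x x' P) (ren x x' Q)
ren x x' (par z y P)    = par (rn x x' z) y (if does (y ≟ x) then P else ren x x' P)
ren x x' (one z)        = one (rn x x' z)
ren x x' (bot z P)      = bot (rn x x' z) (ren x x' P)
ren x x' (wth z P Q)    = wth (rn x x' z) (ren x x' P) (ren x x' Q)
ren x x' (plus₁ z B P)  = plus₁ (rn x x' z) B (ren x x' P)
ren x x' (plus₂ z A P)  = plus₂ (rn x x' z) A (ren x x' P)
ren x x' (top z Γ)      = top (rn x x' z) (map (λ p → rn x x' (proj₁ p) , Data.Product.proj₂ p) Γ)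

CutFree : Term → Set
CutFree (ax A x y)     = ⊤
CutFree (cut A x P Q)  = ⊥
CutFree (tens x y P Q) = CutFree P × CutFree Q
CutFree (par x y P)    = CutFree P
CutFree (one x)        = ⊤
CutFree (bot x P)      = CutFree P
CutFree (wth x P Q)    = CutFree P × CutFree Q
CutFree (plus₁ x B P)  = CutFree P
CutFree (plus₂ x A P)  = CutFree P
CutFree (top x Γ)      = ⊤

data Cong (R : Term → Term → Set) : Term → Term → Set where
  root   : ∀ {P Q} → R P Q → Cong R P Q
  cutˡ   : ∀ {A x P P' Q} → Cong R P P' → Cong R (cut A x P Q) (cut A x P' Q)
  cutʳ   : ∀ {A x P Q Q'} → Cong R Q Q' → Cong R (cut A x P Q) (cut A x P Q')
  tensˡ  : ∀ {x y P P' Q} → Cong R P P' → Cong R (tens x y P Q) (tens x y P' Q)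
  tensʳ  : ∀ {x y P Q Q'} → Cong R Q Q' → Cong R (tens x y P Q) (tens x y P Q')
  parᶜ   : ∀ {x y P P'} → Cong R P P' → Cong R (par x y P) (par x y P')
  botᶜ   : ∀ {x P P'} → Cong R P P' → Cong R (bot x P) (bot x P')
  wthˡ   : ∀ {x P P' Q} → Cong R P P' → Cong R (wth x P Q) (wth x P' Q)
  wthʳ   : ∀ {x P Q Q'} → Cong R Q Q' → Cong R (wth x P Q) (wth x P Q')
  plus₁ᶜ : ∀ {x B P P'} → Cong R P P' → Cong R (plus₁ x B P) (plus₁ x B P')
  plus₂ᶜ : ∀ {x A P P'} → Cong R P P' → Cong R (plus₂ x A P) (plus₂ x A P')

data CutStep : Term → Term → Set where
  ax-l₁ : ∀ {A x z Q} → z ∉ allNames Q → CutStep (cut A x (ax A z x) Q) (ren x z Q)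
  ax-l₂ : ∀ {A B x w Q} → w ∉ allNames Q → CutStep (cut A x (ax B x w) Q) (ren x w Q)
  ax-r₁ : ∀ {A B x z P} → z ∉ allNames P → CutStep (cut A x P (ax B z x)) (ren x z P)
  ax-r₂ : ∀ {A B x w P} → w ∉ allNames P → CutStep (cut A x P (ax B x w)) (ren x w P)
  tens-par : ∀ {A B x y P₁ P₂ Q} →
    CutStep (cut (A ⊗ B) x (tens x y P₁ P₂) (par x y Q)) (cut A y P₁ (cut B x P₂ Q))
  par-tens : ∀ {A B x y P₁ P₂ Q} →
    CutStep (cut (A ⅋ B) x (par x y Q) (tens x y P₁ P₂)) (cut A y (cut B x Q P₂) P₁)
  wth-plus₁ : ∀ {A B C x P Q R} → CutStep (cut (A & B) x (wth x P Q) (plus₁ x C R)) (cut A x P R)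
  wth-plus₂ : ∀ {A B C x P Q R} → CutStep (cut (A & B) x (wth x P Q) (plus₂ x C R)) (cut B x Q R)
  plus₁-wth : ∀ {A B C x P Q R} → CutStep (cut (A ⊕ B) x (plus₁ x C R) (wth x P Q)) (cut A x R P)
  plus₂-wth : ∀ {A B C x P Q R} → CutStep (cut (A ⊕ B) x (plus₂ x C R) (wth x P Q)) (cut B x R Q)
  one-bot : ∀ {x Q} → CutStep (cut 𝟏 x (one x) (bot x Q)) Q
  bot-one : ∀ {x P} → CutStep (cut ⊥ᶠ x (bot x P) (one x)) P
  c-parˡ   : ∀ {A x z y P Q} → z ≢ x → y ≢ x → y ∉ fv Q →
    CutStep (cut A x (par z y P) Q) (par z y (cut A x P Q))
  c-tensˡ₁ : ∀ {A x z y P₁ P₂ Q} → z ≢ x → y ≢ x → x ∈ fv P₁ → y ∉ fv Q →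
    CutStep (cut A x (tens z y P₁ P₂) Q) (tens z y (cut A x P₁ Q) P₂)
  c-tensˡ₂ : ∀ {A x z y P₁ P₂ Q} → z ≢ x → x ∈ fv P₂ → z ∉ fv Q →
    CutStep (cut A x (tens z y P₁ P₂) Q) (tens z y P₁ (cut A x P₂ Q))
  c-botˡ   : ∀ {A x z P Q} → z ≢ x → CutStep (cut A x (bot z P) Q) (bot z (cut A x P Q))
  c-wthˡ   : ∀ {A x z P₁ P₂ Q} → z ≢ x →
    CutStep (cut A x (wth z P₁ P₂) Q) (wth z (cut A x P₁ Q) (cut A x P₂ Q))
  c-plus₁ˡ : ∀ {A B x z P Q} → z ≢ x → CutStep (cut A x (plus₁ z B P) Q) (plus₁ z B (cut A x P Q))
  c-plus₂ˡ : ∀ {A B x z P Q} → z ≢ x → CutStep (cut A x (plus₂ z B P) Q) (plus₂ z B (cut A x P Q))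
  c-topˡ   : ∀ {A x z Γ Γ' Q} → z ≢ x → CutStep (cut A x (top z Γ) Q) (top z Γ')
  c-cutˡ₁  : ∀ {A B x y P₁ P₂ Q} → y ≢ x → x ∈ fv P₁ → y ∉ fv Q →
    CutStep (cut A x (cut B y P₁ P₂) Q) (cut B y (cut A x P₁ Q) P₂)
  c-cutˡ₂  : ∀ {A B x y P₁ P₂ Q} → y ≢ x → x ∈ fv P₂ → y ∉ fv Q →
    CutStep (cut A x (cut B y P₁ P₂) Q) (cut B y P₁ (cut A x P₂ Q))
  c-parʳ   : ∀ {A x z y P Q} → z ≢ x → y ≢ x → y ∉ fv P →
    CutStep (cut A x P (par z y Q)) (par z y (cut A x P Q))
  c-tensʳ₁ : ∀ {A x z y P Q₁ Q₂} → z ≢ x → y ≢ x → x ∈ fv Q₁ → y ∉ fv P →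
    CutStep (cut A x P (tens z y Q₁ Q₂)) (tens z y (cut A x P Q₁) Q₂)
  c-tensʳ₂ : ∀ {A x z y P Q₁ Q₂} → z ≢ x → x ∈ fv Q₂ → z ∉ fv P →
    CutStep (cut A x P (tens z y Q₁ Q₂)) (tens z y Q₁ (cut A x P Q₂))
  c-botʳ   : ∀ {A x z P Q} → z ≢ x → CutStep (cut A x P (bot z Q)) (bot z (cut A x P Q))
  c-wthʳ   : ∀ {A x z P Q₁ Q₂} → z ≢ x →
    CutStep (cut A x P (wth z Q₁ Q₂)) (wth z (cut A x P Q₁) (cut A x P Q₂))
  c-plus₁ʳ : ∀ {A B x z P Q} → z ≢ x → CutStep (cut A x P (plus₁ z B Q)) (plus₁ z B (cut A x P Q))
  c-plus₂ʳ : ∀ {A B x z P Q} → z ≢ x → CutStep (cut A x P (plus₂ z B Q)) (plus₂ z B (cut A x P Q))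
  c-topʳ   : ∀ {A x z Γ Γ' P} → z ≢ x → CutStep (cut A x P (top z Γ)) (top z Γ')
  c-cutʳ₁  : ∀ {A B x y P Q₁ Q₂} → y ≢ x → x ∈ fv Q₁ → y ∉ fv P →
    CutStep (cut A x P (cut B y Q₁ Q₂)) (cut B y (cut A x P Q₁) Q₂)
  c-cutʳ₂  : ∀ {A B x y P Q₁ Q₂} → y ≢ x → x ∈ fv Q₂ → y ∉ fv P →
    CutStep (cut A x P (cut B y Q₁ Q₂)) (cut B y Q₁ (cut A x P Q₂))

-- Presentation steps: renaming of bound names (α) and reordering of the
-- context stored in a ⊤-rule.  Both are the identity on MALL proofs.
data Alpha : Term → Term → Set where
  α-cut  : ∀ {A x x' P Q} → x' ∉ allNames P → x' ∉ allNames Q →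
    Alpha (cut A x P Q) (cut A x' (ren x x' P) (ren x x' Q))
  α-tens : ∀ {z y y' P Q} → y' ∉ allNames P → Alpha (tens z y P Q) (tens z y' (ren y y' P) Q)
  α-par  : ∀ {z y y' P} → y' ∉ allNames P → Alpha (par z y P) (par z y' (ren y y' P))
  α-top  : ∀ {z Γ Γ'} → Γ ↭ Γ' → Alpha (top z Γ) (top z Γ')

data RootStep (P Q : Term) : Set where
  β-root : CutStep P Q → RootStep P Q
  α-root : Alpha P Q → RootStep P Q

infix 4 _=β_
data _=β_ : Term → Term → Set where
  =β-step  : ∀ {P Q Γ} → P ⊢ Γ → Q ⊢ Γ → Cong RootStep P Q → P =β Q
  =β-refl  : ∀ {P} → P =β P
  =β-sym   : ∀ {P Q} → P =β Q → Q =β P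
  =β-trans : ∀ {P Q R} → P =β Q → Q =β R → P =β R

-- A "linear" rule with one distinguished premise replaced by a hole
-- (⅋, ⊥, ⊕₁, ⊕₂, and ⊗ with its other premise as side proof).
data Frame : Set where
  parF    : Name → Name → Frame
  botF    : Name → Frame
  plus₁F  : Name → Formula → Frame
  plus₂F  : Name → Formula → Frame
  tensLF  : Name → Name → Term → Frame
  tensRF  : Name → Name → Term → Frame

plug : Frame → Term → Term
plug (parF x y) R     = par x y R
plug (botF x) R       = bot x R
plug (plus₁F x B) R   = plus₁ x B R
plug (plus₂F x A) R   = plus₂ x A R
plug (tensLF x y Q) R = tens x y R Q
plug (tensRF x y P) R = tens x y P R

principal : Frame → Name
principal (parF x y)     = x
principal (botF x)       = x
principal (plus₁F x B)   = x
principal (plus₂F x A)   = x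
principal (tensLF x y Q) = x
principal (tensRF x y P) = x

-- names of the formulas the rule acts on in the hole premise
active : Frame → List Name
active (parF x y)     = y ∷ x ∷ []
active (botF x)       = []
active (plus₁F x B)   = x ∷ []
active (plus₂F x A)   = x ∷ []
active (tensLF x y Q) = y ∷ []
active (tensRF x y P) = x ∷ []

binders : Frame → List Name
binders (parF x y)     = y ∷ []
binders (tensLF x y Q) = y ∷ []
binders _              = []

frameNames : Frame → List Name
frameNames (tensLF x y Q) = x ∷ y ∷ allNames Q
frameNames (tensRF x y P) = x ∷ y ∷ allNames P
frameNames F              = principal F ∷ binders F

data RootComm : Term → Term → Set where
  lin-lin  : ∀ {F G R} → principal G ∉ active F → principal F ∉ active G →
             principal F ≢ principal G →
             Disjoint (binders F) (frameNames G) → Disjoint (binders G) (frameNames F) →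
             RootComm (plug F (plug G R)) (plug G (plug F R))
  lin-wth  : ∀ {H b R₁ R₂} → b ∉ principal H ∷ active H → b ∉ binders H →
             RootComm (plug H (wth b R₁ R₂)) (wth b (plug H R₁) (plug H R₂))
  wth-wth  : ∀ {a b R₁ R₂ R₃ R₄} → a ≢ b →
             RootComm (wth a (wth b R₁ R₂) (wth b R₃ R₄)) (wth b (wth a R₁ R₃) (wth a R₂ R₄))
  -- ⊤-rule commuted down through a linear rule (erasing it and its side proof)
  lin-top  : ∀ {H b Γ Γ'} → b ∉ principal H ∷ active H →
             RootComm (plug H (top b Γ)) (top b Γ')
  wth-top  : ∀ {a b Γ₁ Γ₂ Γ} → a ≢ b → RootComm (wth a (top b Γ₁) (top b Γ₂)) (top b Γ)
  -- two ⊤-rules: change which ⊤ is principal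
  top-top  : ∀ {a b Γ Γ'} → a ≢ b → RootComm (top a Γ) (top b Γ')

data Comm (P Q : Term) : Set where
  comm : ∀ {Δ} → P ⊢ Δ → Q ⊢ Δ → CutFree P → CutFree Q →
         RootComm P Q ⊎ RootComm Q P → Comm P Q

infix 4 _≡₁_
_≡₁_ : Term → Term → Set
_≡₁_ = Cong Comm

module Submission where

-- Each commutation is simulated by cut-elimination through an η-expansion.
-- If a rule r acts on the formulas I of a cut-free proof R of ⊢ I, Γ, then R
-- is β-equal to a cut between R with I packed into one fresh formula c (by ⊥,
-- a renaming, or ⅋) and the η-expanded identity on I (1, an axiom, or a tensor
-- of two axioms).  Rule r applied to that identity is then a proof E_r sitting
-- on the far side of a cut, and commutative cut steps push a neighbouring rule s
-- either above or below E_r: both orders of r and s reduce to the same proof.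
-- A &-rule is isolated the same way by cutting against a &-proof of two
-- ⊕-expanded axioms, and a ⊤-rule that absorbs other rules is obtained by
-- cutting a ⊤-proof against them.  Bound names are first renamed apart
-- (α-steps), so that all commutative steps are capture-free.

open import Defs
open import Data.Nat as ℕ using (ℕ; suc; _≤_; _⊔_; _≟_)
import Data.Nat.Properties as ℕ
open import Data.Product using (_×_; _,_; proj₁; proj₂; Σ; ∃; Σ-syntax)
open import Data.Sum using (_⊎_; inj₁; inj₂)
open import Data.Empty using (⊥-elim)
open import Data.Unit using (tt)
open import Data.Bool using (true; false; T)
open import Data.List using (List; []; _∷_; _++_; map; [_])
open import Data.List.Properties using (map-++)
open import Data.List.Membership.Propositional using (_∈_; _∉_)
open import Data.List.Membership.Propositional.Properties
  using (∈-++⁺ˡ; ∈-++⁺ʳ; ∈-++⁻; ∈-∃++; ∈-map⁺; ∈-filter⁺; ∈-filter⁻)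
open import Data.List.Relation.Unary.Any using (here; there)
open import Data.List.Relation.Unary.All using ([]; _∷_)
open import Data.List.Relation.Unary.All.Properties using (¬Any⇒All¬; ++⁻ˡ)
open import Data.List.Relation.Unary.Unique.Propositional using (Unique; []; _∷_)
open import Data.List.Relation.Unary.Unique.Propositional.Properties
  using (Unique[x∷xs]⇒x∉xs) renaming (++⁺ to Unique-++⁺)
open import Data.List.Relation.Binary.Permutation.Propositional
open import Data.List.Relation.Binary.Permutation.Propositional.Properties
  using (All-resp-↭; ∈-resp-↭; drop-∷; shift; ++⁺ˡ; ++-comm; ++-commutativeMonoid)
  renaming (map⁺ to ↭-map⁺; ++⁺ to ↭-++⁺)
open import Algebra.Solver.CommutativeMonoid (++-commutativeMonoid {A = Name × Formula})
  using (solve; _⊜_) renaming (_⊕_ to _∙_)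
open import Data.List.Relation.Binary.Disjoint.Propositional using (Disjoint)
open import Relation.Nullary using (yes; no; ¬?)
open import Relation.Binary.PropositionalEquality
  using (_≡_; refl; sym; cong; cong₂; subst; _≢_)
  renaming (trans to ≡-trans)

Unique-resp-↭ : ∀ {A : Set} {xs ys : List A} → xs ↭ ys → Unique xs → Unique ys
Unique-resp-↭ refl u = u
Unique-resp-↭ (prep x p) (a ∷ u) = All-resp-↭ p a ∷ Unique-resp-↭ p u
Unique-resp-↭ (swap x y p) ((x≢y ∷ x≢) ∷ y≢ ∷ u) =
  ((λ e → x≢y (sym e)) ∷ All-resp-↭ p y≢) ∷ All-resp-↭ p x≢ ∷ Unique-resp-↭ p u
Unique-resp-↭ (trans p q) u = Unique-resp-↭ q (Unique-resp-↭ p u)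

Unique-tail : ∀ {A : Set} {x : A} {xs} → Unique (x ∷ xs) → Unique xs
Unique-tail (_ ∷ u) = u

Unique-head : ∀ {A : Set} {x : A} {xs} → Unique (x ∷ xs) → x ∉ xs
Unique-head = Unique[x∷xs]⇒x∉xs

Unique-∷ : ∀ {A : Set} {x : A} {xs} → x ∉ xs → Unique xs → Unique (x ∷ xs)
Unique-∷ x∉ u = ¬Any⇒All¬ _ x∉ ∷ u

Unique-++⁻ˡ : ∀ {A : Set} (xs : List A) {ys} → Unique (xs ++ ys) → Unique xs
Unique-++⁻ˡ [] u = []
Unique-++⁻ˡ (x ∷ xs) (a ∷ u) = ++⁻ˡ xs a ∷ Unique-++⁻ˡ xs u

Unique-++⁻ʳ : ∀ {A : Set} (xs : List A) {ys} → Unique (xs ++ ys) → Unique ys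
Unique-++⁻ʳ [] u = u
Unique-++⁻ʳ (x ∷ xs) (_ ∷ u) = Unique-++⁻ʳ xs u

Unique-++-disjoint : ∀ {A : Set} (xs : List A) {ys z} → Unique (xs ++ ys) → z ∈ xs → z ∉ ys
Unique-++-disjoint (x ∷ xs) u (here refl) z∈ = Unique-head u (∈-++⁺ʳ xs z∈)
Unique-++-disjoint (x ∷ xs) (_ ∷ u) (there i) z∈ = Unique-++-disjoint xs u i z∈

∉-resp-↭ : ∀ {A : Set} {x : A} {xs ys} → xs ↭ ys → x ∉ xs → x ∉ ys
∉-resp-↭ p x∉ x∈ = x∉ (∈-resp-↭ (↭-sym p) x∈)

∈-∷⁻ : ∀ {A : Set} {z x : A} {xs} → z ∈ x ∷ xs → z ≢ x → z ∈ xs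
∈-∷⁻ (here e) n = ⊥-elim (n e)
∈-∷⁻ (there i) _ = i

∉∷⁻ʰ : ∀ {A : Set} {z a : A} {xs} → z ∉ a ∷ xs → z ≢ a
∉∷⁻ʰ n e = n (here e)

∉∷⁻ᵗ : ∀ {A : Set} {z a : A} {xs} → z ∉ a ∷ xs → z ∉ xs
∉∷⁻ᵗ n i = n (there i)

∉∷⁺ : ∀ {A : Set} {z a : A} {xs} → z ≢ a → z ∉ xs → z ∉ a ∷ xs
∉∷⁺ n m (here e) = n e
∉∷⁺ n m (there i) = m i

∉++⁻ˡ : ∀ {A : Set} {z : A} xs {ys} → z ∉ xs ++ ys → z ∉ xs
∉++⁻ˡ xs n i = n (∈-++⁺ˡ i)

∉++⁻ʳ : ∀ {A : Set} {z : A} xs {ys} → z ∉ xs ++ ys → z ∉ ys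
∉++⁻ʳ xs n i = n (∈-++⁺ʳ xs i)

∉++⁺ : ∀ {A : Set} {z : A} xs {ys} → z ∉ xs → z ∉ ys → z ∉ xs ++ ys
∉++⁺ xs n m i with ∈-++⁻ xs i
... | inj₁ j = n j
... | inj₂ j = m j

∉⇒≢ : ∀ {A : Set} {x z : A} {xs} → x ∉ xs → z ∈ xs → x ≢ z
∉⇒≢ n i refl = n i

≢-sym : ∀ {A : Set} {a b : A} → a ≢ b → b ≢ a
≢-sym n e = n (sym e)

∈-split : ∀ {A : Set} {x : A} {xs} → x ∈ xs → Σ (List A) λ ys → xs ↭ x ∷ ys
∈-split {x = x} i with ∈-∃++ i
... | ys , zs , refl = ys ++ zs , shift x ys zs

max : List ℕ → ℕ
max [] = 0
max (x ∷ xs) = x ⊔ max xs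

≤max : ∀ {x} xs → x ∈ xs → x ≤ max xs
≤max (y ∷ ys) (here refl) = ℕ.m≤m⊔n y (max ys)
≤max (y ∷ ys) (there i) = ℕ.≤-trans (≤max ys i) (ℕ.m≤n⊔m y (max ys))

fresh : List ℕ → ℕ
fresh xs = suc (max xs)

fresh∉ : ∀ xs → fresh xs ∉ xs
fresh∉ xs i = ℕ.<-irrefl refl (≤max xs i)

names-↭ : ∀ {Γ Δ : Sequent} → Γ ↭ Δ → names Γ ↭ names Δ
names-↭ = ↭-map⁺ proj₁

names-++ : ∀ (Γ Δ : Sequent) → names (Γ ++ Δ) ≡ names Γ ++ names Δ
names-++ = map-++ proj₁

Unique-names-resp-↭ : ∀ {Γ Δ : Sequent} → Γ ↭ Δ → Unique (names Γ) → Unique (names Δ)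
Unique-names-resp-↭ p = Unique-resp-↭ (names-↭ p)

∉names-resp-↭ : ∀ {c : Name} {Γ Δ : Sequent} → Γ ↭ Δ → c ∉ names Δ → c ∉ names Γ
∉names-resp-↭ p = ∉-resp-↭ (names-↭ (↭-sym p))

names-++⁻ : ∀ {z} (Γ : Sequent) {Δ} → z ∈ names (Γ ++ Δ) → z ∈ names Γ ⊎ z ∈ names Δ
names-++⁻ Γ {Δ} i rewrite names-++ Γ Δ = ∈-++⁻ (names Γ) i

names-++⁺ˡ : ∀ {z} {Γ : Sequent} Δ → z ∈ names Γ → z ∈ names (Γ ++ Δ)
names-++⁺ˡ {Γ = Γ} Δ i rewrite names-++ Γ Δ = ∈-++⁺ˡ i

names-++⁺ʳ : ∀ {z} (Γ : Sequent) {Δ} → z ∈ names Δ → z ∈ names (Γ ++ Δ)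
names-++⁺ʳ Γ {Δ} i rewrite names-++ Γ Δ = ∈-++⁺ʳ (names Γ) i

∉names-++⁻ˡ : ∀ {c : Name} (Γ : Sequent) {Δ} → c ∉ names (Γ ++ Δ) → c ∉ names Γ
∉names-++⁻ˡ Γ n i = n (names-++⁺ˡ _ i)

∉names-++⁻ʳ : ∀ {c : Name} (Γ : Sequent) {Δ} → c ∉ names (Γ ++ Δ) → c ∉ names Δ
∉names-++⁻ʳ Γ n i = n (names-++⁺ʳ Γ i)

∉names-++⁺ : ∀ {c : Name} (Γ : Sequent) {Δ} → c ∉ names Γ → c ∉ names Δ → c ∉ names (Γ ++ Δ)
∉names-++⁺ Γ n m i with names-++⁻ Γ i
... | inj₁ j = n j
... | inj₂ j = m j

Unique-names-++⁻ˡ : ∀ (Γ : Sequent) {Δ} → Unique (names (Γ ++ Δ)) → Unique (names Γ)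
Unique-names-++⁻ˡ Γ {Δ} u = Unique-++⁻ˡ (names Γ) (subst Unique (names-++ Γ Δ) u)

Unique-names-++⁻ʳ : ∀ (Γ : Sequent) {Δ} → Unique (names (Γ ++ Δ)) → Unique (names Δ)
Unique-names-++⁻ʳ Γ {Δ} u = Unique-++⁻ʳ (names Γ) (subst Unique (names-++ Γ Δ) u)

Unique-names-disjoint : ∀ (Γ : Sequent) {Δ z} → Unique (names (Γ ++ Δ)) → z ∈ names Γ → z ∉ names Δ
Unique-names-disjoint Γ {Δ} u = Unique-++-disjoint (names Γ) (subst Unique (names-++ Γ Δ) u)

Unique-names-++⁺ : ∀ (Γ Δ : Sequent) → Unique (names Γ) → Unique (names Δ) →
  (∀ {z} → z ∈ names Γ → z ∉ names Δ) → Unique (names (Γ ++ Δ))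
Unique-names-++⁺ Γ Δ u v dj = subst Unique (sym (names-++ Γ Δ)) (Unique-++⁺ u v (λ (i , j) → dj i j))

names-∈ : ∀ {z : Name} {X : Formula} {Γ : Sequent} → (z , X) ∈ Γ → z ∈ names Γ
names-∈ = ∈-map⁺ proj₁

↭-head⁻ : ∀ {y : Name} {A A' : Formula} {Γ Δ : Sequent} → Unique (names ((y , A') ∷ Δ)) →
  (y , A) ∷ Γ ↭ (y , A') ∷ Δ → A ≡ A' × Γ ↭ Δ
↭-head⁻ u p with ∈-resp-↭ p (here refl)
... | here refl = refl , drop-∷ p
... | there i = ⊥-elim (Unique-head u (names-∈ i))

↭-extract : ∀ (Γ Δ Σ Π : Sequent) → Unique (names (Γ ++ Δ)) → (∀ {z} → z ∈ names Σ → z ∉ names Γ) →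
  Γ ++ Δ ↭ Σ ++ Π → Σ[ Θ ∈ Sequent ] (Δ ↭ Σ ++ Θ) × (Π ↭ Γ ++ Θ)
↭-extract Γ Δ [] Π u dj p = Δ , refl , ↭-sym p
↭-extract Γ Δ ((z , X) ∷ Σ) Π u dj p with ∈-++⁻ Γ (∈-resp-↭ (↭-sym p) (here refl))
... | inj₁ i = ⊥-elim (dj (here refl) (names-∈ i))
... | inj₂ i with ∈-split i
... | Δ' , r with ↭-extract Γ Δ' Σ Π
                   (Unique-tail (Unique-names-resp-↭ (shift (z , X) Γ Δ') (Unique-names-resp-↭ (++⁺ˡ Γ r) u)))
                   (λ k → dj (there k))
                   (drop-∷ (trans (↭-sym (shift (z , X) Γ Δ')) (trans (++⁺ˡ Γ (↭-sym r)) p)))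
... | Θ , r₁ , r₂ = Θ , trans r (prep _ r₁) , r₂

-- Typing invariants

⊢-Unique : ∀ {P Γ} → P ⊢ Γ → Unique (names Γ)
⊢-Unique (⊢ex p d) = Unique-names-resp-↭ p (⊢-Unique d)
⊢-Unique (⊢ax x≢y) = (x≢y ∷ []) ∷ [] ∷ []
⊢-Unique (⊢cut d e u) = u
⊢-Unique (⊢tens d e u) = u
⊢-Unique (⊢par d) = Unique-tail (⊢-Unique d)
⊢-Unique ⊢one = [] ∷ []
⊢-Unique (⊢bot d x∉) = Unique-∷ x∉ (⊢-Unique d)
⊢-Unique (⊢wth d e) = ⊢-Unique d
⊢-Unique (⊢plus₁ d) = ⊢-Unique d
⊢-Unique (⊢plus₂ d) = ⊢-Unique d
⊢-Unique (⊢top u) = u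

⊢-swap : ∀ {P x X y Y Γ} → P ⊢ (x , X) ∷ (y , Y) ∷ Γ → P ⊢ (y , Y) ∷ (x , X) ∷ Γ
⊢-swap = ⊢ex (swap _ _ refl)

⊢cut′ : ∀ {A c R E Γ Δ} → R ⊢ (c , A) ∷ Γ → E ⊢ (c , dual A) ∷ Δ → Unique (names (Δ ++ Γ)) →
  cut A c R E ⊢ Δ ++ Γ
⊢cut′ {Γ = Γ} {Δ} d e u = ⊢ex (++-comm Γ Δ) (⊢cut d e (Unique-names-resp-↭ (++-comm Δ Γ) u))

inv-ax : ∀ {A x y Δ} → ax A x y ⊢ Δ → ((x , dual A) ∷ (y , A) ∷ []) ↭ Δ × x ≢ y
inv-ax (⊢ex p d) with inv-ax d
... | q , n = trans q p , n
inv-ax (⊢ax n) = refl , n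

inv-cut : ∀ {A x P Q Δ} → cut A x P Q ⊢ Δ →
  Σ[ Γ₁ ∈ Sequent ] Σ[ Δ₁ ∈ Sequent ] (P ⊢ (x , A) ∷ Γ₁) × (Q ⊢ (x , dual A) ∷ Δ₁) × Unique (names (Γ₁ ++ Δ₁)) × (Γ₁ ++ Δ₁) ↭ Δ
inv-cut (⊢ex p d) with inv-cut d
... | Γ₁ , Δ₁ , a , b , u , q = Γ₁ , Δ₁ , a , b , u , trans q p
inv-cut (⊢cut a b u) = _ , _ , a , b , u , refl

inv-tens : ∀ {x y P Q Δ} → tens x y P Q ⊢ Δ →
  Σ[ A ∈ Formula ] Σ[ B ∈ Formula ] Σ[ Γ₁ ∈ Sequent ] Σ[ Δ₁ ∈ Sequent ]
  (P ⊢ (y , A) ∷ Γ₁) × (Q ⊢ (x , B) ∷ Δ₁) × Unique (names ((x , A ⊗ B) ∷ Γ₁ ++ Δ₁)) × ((x , A ⊗ B) ∷ Γ₁ ++ Δ₁) ↭ Δ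
inv-tens (⊢ex p d) with inv-tens d
... | A , B , Γ₁ , Δ₁ , a , b , u , q = A , B , Γ₁ , Δ₁ , a , b , u , trans q p
inv-tens (⊢tens a b u) = _ , _ , _ , _ , a , b , u , refl

inv-par : ∀ {x y P Δ} → par x y P ⊢ Δ →
  Σ[ A ∈ Formula ] Σ[ B ∈ Formula ] Σ[ Γ₁ ∈ Sequent ]
  (P ⊢ (y , A) ∷ (x , B) ∷ Γ₁) × ((x , A ⅋ B) ∷ Γ₁) ↭ Δ
inv-par (⊢ex p d) with inv-par d
... | A , B , Γ₁ , a , q = A , B , Γ₁ , a , trans q p
inv-par (⊢par a) = _ , _ , _ , a , refl

inv-one : ∀ {x Δ} → one x ⊢ Δ → ((x , 𝟏) ∷ []) ↭ Δ
inv-one (⊢ex p d) = trans (inv-one d) p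
inv-one ⊢one = refl

inv-bot : ∀ {x P Δ} → bot x P ⊢ Δ → Σ[ Γ₁ ∈ Sequent ] (P ⊢ Γ₁) × x ∉ names Γ₁ × ((x , ⊥ᶠ) ∷ Γ₁) ↭ Δ
inv-bot (⊢ex p d) with inv-bot d
... | Γ₁ , a , n , q = Γ₁ , a , n , trans q p
inv-bot (⊢bot a n) = _ , a , n , refl

inv-wth : ∀ {x P Q Δ} → wth x P Q ⊢ Δ →
  Σ[ A ∈ Formula ] Σ[ B ∈ Formula ] Σ[ Γ₁ ∈ Sequent ]
  (P ⊢ (x , A) ∷ Γ₁) × (Q ⊢ (x , B) ∷ Γ₁) × ((x , A & B) ∷ Γ₁) ↭ Δ
inv-wth (⊢ex p d) with inv-wth d
... | A , B , Γ₁ , a , b , q = A , B , Γ₁ , a , b , trans q p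
inv-wth (⊢wth a b) = _ , _ , _ , a , b , refl

inv-plus₁ : ∀ {x B P Δ} → plus₁ x B P ⊢ Δ →
  Σ[ A ∈ Formula ] Σ[ Γ₁ ∈ Sequent ] (P ⊢ (x , A) ∷ Γ₁) × ((x , A ⊕ B) ∷ Γ₁) ↭ Δ
inv-plus₁ (⊢ex p d) with inv-plus₁ d
... | A , Γ₁ , a , q = A , Γ₁ , a , trans q p
inv-plus₁ (⊢plus₁ a) = _ , _ , a , refl

inv-plus₂ : ∀ {x A P Δ} → plus₂ x A P ⊢ Δ →
  Σ[ B ∈ Formula ] Σ[ Γ₁ ∈ Sequent ] (P ⊢ (x , B) ∷ Γ₁) × ((x , A ⊕ B) ∷ Γ₁) ↭ Δ
inv-plus₂ (⊢ex p d) with inv-plus₂ d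
... | B , Γ₁ , a , q = B , Γ₁ , a , trans q p
inv-plus₂ (⊢plus₂ a) = _ , _ , a , refl

inv-top : ∀ {x Γ Δ} → top x Γ ⊢ Δ → Unique (names ((x , ⊤ᶠ) ∷ Γ)) × ((x , ⊤ᶠ) ∷ Γ) ↭ Δ
inv-top (⊢ex p d) with inv-top d
... | u , q = u , trans q p
inv-top (⊢top u) = u , refl

⊢-unique : ∀ P {Γ Δ} → P ⊢ Γ → P ⊢ Δ → Γ ↭ Δ
⊢-unique (ax A x y) d e = trans (↭-sym (proj₁ (inv-ax d))) (proj₁ (inv-ax e))
⊢-unique (cut A x P Q) d e with inv-cut d | inv-cut e
... | Γ₁ , Δ₁ , a , b , u , q | Γ₂ , Δ₂ , a' , b' , u' , q' =
  trans (↭-sym q) (trans (↭-++⁺ (drop-∷ (⊢-unique P a a')) (drop-∷ (⊢-unique Q b b'))) q')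
⊢-unique (tens x y P Q) d e with inv-tens d | inv-tens e
... | A , B , Γ₁ , Δ₁ , a , b , u , q | A' , B' , Γ₂ , Δ₂ , a' , b' , u' , q'
  with ↭-head⁻ (⊢-Unique a') (⊢-unique P a a') | ↭-head⁻ (⊢-Unique b') (⊢-unique Q b b')
... | refl , r1 | refl , r2 = trans (↭-sym q) (trans (prep _ (↭-++⁺ r1 r2)) q')
⊢-unique (par x y P) d e with inv-par d | inv-par e
... | A , B , Γ₁ , a , q | A' , B' , Γ₂ , a' , q' with ↭-head⁻ (⊢-Unique a') (⊢-unique P a a')
... | refl , r with ↭-head⁻ (Unique-tail (⊢-Unique a')) r
... | refl , r' = trans (↭-sym q) (trans (prep _ r') q')
⊢-unique (one x) d e = trans (↭-sym (inv-one d)) (inv-one e)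
⊢-unique (bot x P) d e with inv-bot d | inv-bot e
... | Γ₁ , a , n , q | Γ₂ , a' , n' , q' = trans (↭-sym q) (trans (prep _ (⊢-unique P a a')) q')
⊢-unique (wth x P Q) d e with inv-wth d | inv-wth e
... | A , B , Γ₁ , a , b , q | A' , B' , Γ₂ , a' , b' , q'
  with ↭-head⁻ (⊢-Unique a') (⊢-unique P a a') | ↭-head⁻ (⊢-Unique b') (⊢-unique Q b b')
... | refl , r1 | refl , r2 = trans (↭-sym q) (trans (prep _ r1) q')
⊢-unique (plus₁ x B P) d e with inv-plus₁ d | inv-plus₁ e
... | A , Γ₁ , a , q | A' , Γ₂ , a' , q' with ↭-head⁻ (⊢-Unique a') (⊢-unique P a a')
... | refl , r = trans (↭-sym q) (trans (prep _ r) q')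
⊢-unique (plus₂ x A P) d e with inv-plus₂ d | inv-plus₂ e
... | B , Γ₁ , a , q | B' , Γ₂ , a' , q' with ↭-head⁻ (⊢-Unique a') (⊢-unique P a a')
... | refl , r = trans (↭-sym q) (trans (prep _ r) q')
⊢-unique (top x Γ) d e = trans (↭-sym (proj₂ (inv-top d))) (proj₂ (inv-top e))

⊢top-second : ∀ {b c X Θ} → Unique (names ((b , ⊤ᶠ) ∷ Θ)) → c ∉ names ((b , ⊤ᶠ) ∷ Θ) →
  top b ((c , X) ∷ Θ) ⊢ (c , X) ∷ (b , ⊤ᶠ) ∷ Θ
⊢top-second u c∉ = ⊢-swap (⊢top (Unique-resp-↭ (swap _ _ refl) (Unique-∷ c∉ u)))

∈-rm⁺ : ∀ {z x xs} → z ∈ xs → z ≢ x → z ∈ rm x xs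
∈-rm⁺ {x = x} i n = ∈-filter⁺ (λ y → ¬? (y ≟ x)) i n

∈-rm⁻ : ∀ {z x} xs → z ∈ rm x xs → z ∈ xs × z ≢ x
∈-rm⁻ {x = x} _ i = ∈-filter⁻ (λ y → ¬? (y ≟ x)) i

rm⊆ : ∀ {z x} xs → z ∈ rm x xs → z ∈ xs
rm⊆ xs i = proj₁ (∈-rm⁻ xs i)

⊢-≢head : ∀ {P x A Γ z} → P ⊢ (x , A) ∷ Γ → z ∈ names Γ → z ≢ x
⊢-≢head d i = ≢-sym (∉⇒≢ (Unique-head (⊢-Unique d)) i)

fv⊆names : ∀ {P Γ z} → P ⊢ Γ → z ∈ fv P → z ∈ names Γ
fv⊆names (⊢ex p d) i = ∈-resp-↭ (names-↭ p) (fv⊆names d i)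
fv⊆names (⊢ax _) i = i
fv⊆names {cut A x P Q} (⊢cut {Γ = Γ} d e u) i with ∈-rm⁻ (fv P ++ fv Q) i
... | j , n with ∈-++⁻ (fv P) j
... | inj₁ k = names-++⁺ˡ _ (∈-∷⁻ (fv⊆names d k) n)
... | inj₂ k = names-++⁺ʳ Γ (∈-∷⁻ (fv⊆names e k) n)
fv⊆names (⊢tens d e u) (here refl) = here refl
fv⊆names {tens x y P Q} (⊢tens {Γ = Γ} d e u) (there i) with ∈-++⁻ (rm y (fv P)) i
... | inj₁ j = there (names-++⁺ˡ _ (∈-∷⁻ (fv⊆names d (rm⊆ (fv P) j)) (proj₂ (∈-rm⁻ (fv P) j))))
... | inj₂ j = there (names-++⁺ʳ Γ (∈-∷⁻ (fv⊆names e (rm⊆ (fv Q) j)) (proj₂ (∈-rm⁻ (fv Q) j))))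
fv⊆names (⊢par d) (here refl) = here refl
fv⊆names {par x y P} (⊢par d) (there i) with ∈-rm⁻ (rm x (fv P)) i
... | j , n with ∈-rm⁻ (fv P) j
... | k , n' = there (∈-∷⁻ (∈-∷⁻ (fv⊆names d k) n) n')
fv⊆names ⊢one i = i
fv⊆names (⊢bot d _) (here refl) = here refl
fv⊆names (⊢bot d _) (there i) = there (fv⊆names d i)
fv⊆names (⊢wth d e) (here refl) = here refl
fv⊆names {wth x P Q} (⊢wth d e) (there i) with ∈-rm⁻ (fv P ++ fv Q) i
... | j , n with ∈-++⁻ (fv P) j
... | inj₁ k = there (∈-∷⁻ (fv⊆names d k) n)
... | inj₂ k = there (∈-∷⁻ (fv⊆names e k) n)
fv⊆names (⊢plus₁ d) (here refl) = here refl
fv⊆names {plus₁ x B P} (⊢plus₁ d) (there i) = there (∈-∷⁻ (fv⊆names d (rm⊆ (fv P) i)) (proj₂ (∈-rm⁻ (fv P) i)))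
fv⊆names (⊢plus₂ d) (here refl) = here refl
fv⊆names {plus₂ x A P} (⊢plus₂ d) (there i) = there (∈-∷⁻ (fv⊆names d (rm⊆ (fv P) i)) (proj₂ (∈-rm⁻ (fv P) i)))
fv⊆names (⊢top u) i = i

names⊆fv : ∀ {P Γ z} → P ⊢ Γ → z ∈ names Γ → z ∈ fv P
names⊆fv (⊢ex p d) i = names⊆fv d (∈-resp-↭ (names-↭ (↭-sym p)) i)
names⊆fv (⊢ax _) i = i
names⊆fv {cut A x P Q} (⊢cut {Γ = Γ} d e u) i with names-++⁻ Γ i
... | inj₁ j = ∈-rm⁺ (∈-++⁺ˡ (names⊆fv d (there j))) (⊢-≢head d j)
... | inj₂ j = ∈-rm⁺ (∈-++⁺ʳ (fv P) (names⊆fv e (there j))) (⊢-≢head e j)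
names⊆fv (⊢tens d e u) (here refl) = here refl
names⊆fv {tens x y P Q} (⊢tens {Γ = Γ} d e u) (there i) with names-++⁻ Γ i
... | inj₁ j = there (∈-++⁺ˡ (∈-rm⁺ (names⊆fv d (there j)) (⊢-≢head d j)))
... | inj₂ j = there (∈-++⁺ʳ (rm y (fv P)) (∈-rm⁺ (names⊆fv e (there j)) (⊢-≢head e j)))
names⊆fv (⊢par d) (here refl) = here refl
names⊆fv (⊢par d) (there i) =
  there (∈-rm⁺ (∈-rm⁺ (names⊆fv d (there (there i))) (⊢-≢head (⊢-swap d) (there i))) (⊢-≢head d (there i)))
names⊆fv ⊢one i = i
names⊆fv (⊢bot d _) (here refl) = here refl
names⊆fv (⊢bot d _) (there i) = there (names⊆fv d i)
names⊆fv (⊢wth d e) (here refl) = here refl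
names⊆fv (⊢wth d e) (there i) = there (∈-rm⁺ (∈-++⁺ˡ (names⊆fv d (there i))) (⊢-≢head d i))
names⊆fv (⊢plus₁ d) (here refl) = here refl
names⊆fv (⊢plus₁ d) (there i) = there (∈-rm⁺ (names⊆fv d (there i)) (⊢-≢head d i))
names⊆fv (⊢plus₂ d) (here refl) = here refl
names⊆fv (⊢plus₂ d) (there i) = there (∈-rm⁺ (names⊆fv d (there i)) (⊢-≢head d i))
names⊆fv (⊢top u) i = i

∉names⇒∉fv : ∀ {P Γ z} → P ⊢ Γ → z ∉ names Γ → z ∉ fv P
∉names⇒∉fv d n i = n (fv⊆names d i)

fv⊆allNames : ∀ P {z} → z ∈ fv P → z ∈ allNames P
fv⊆allNames (ax A x y) i = i
fv⊆allNames (cut A x P Q) i with ∈-++⁻ (fv P) (rm⊆ (fv P ++ fv Q) i)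
... | inj₁ j = there (∈-++⁺ˡ (fv⊆allNames P j))
... | inj₂ j = there (∈-++⁺ʳ (allNames P) (fv⊆allNames Q j))
fv⊆allNames (tens x y P Q) (here e) = here e
fv⊆allNames (tens x y P Q) (there i) with ∈-++⁻ (rm y (fv P)) i
... | inj₁ j = there (there (∈-++⁺ˡ (fv⊆allNames P (rm⊆ (fv P) j))))
... | inj₂ j = there (there (∈-++⁺ʳ (allNames P) (fv⊆allNames Q (rm⊆ (fv Q) j))))
fv⊆allNames (par x y P) (here e) = here e
fv⊆allNames (par x y P) (there i) = there (there (fv⊆allNames P (rm⊆ (fv P) (rm⊆ (rm x (fv P)) i))))
fv⊆allNames (one x) i = i
fv⊆allNames (bot x P) (here e) = here e
fv⊆allNames (bot x P) (there i) = there (fv⊆allNames P i)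
fv⊆allNames (wth x P Q) (here e) = here e
fv⊆allNames (wth x P Q) (there i) with ∈-++⁻ (fv P) (rm⊆ (fv P ++ fv Q) i)
... | inj₁ j = there (∈-++⁺ˡ (fv⊆allNames P j))
... | inj₂ j = there (∈-++⁺ʳ (allNames P) (fv⊆allNames Q j))
fv⊆allNames (plus₁ x B P) (here e) = here e
fv⊆allNames (plus₁ x B P) (there i) = there (fv⊆allNames P (rm⊆ (fv P) i))
fv⊆allNames (plus₂ x A P) (here e) = here e
fv⊆allNames (plus₂ x A P) (there i) = there (fv⊆allNames P (rm⊆ (fv P) i))
fv⊆allNames (top x Γ) i = i

names⊆allNames : ∀ {P Γ z} → P ⊢ Γ → z ∈ names Γ → z ∈ allNames P
names⊆allNames {P} d i = fv⊆allNames P (names⊆fv d i)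

∉allNames⇒∉names : ∀ {P Γ z} → P ⊢ Γ → z ∉ allNames P → z ∉ names Γ
∉allNames⇒∉names d n i = n (names⊆allNames d i)

-- rn tests names with the builtin y ℕ.≡ᵇ x (the computational content of _≟_),
-- so its clauses are selected by rewriting with these two facts.
≡ᵇ-true : ∀ y x → y ≡ x → (y ℕ.≡ᵇ x) ≡ true
≡ᵇ-true y x e with y ℕ.≡ᵇ x in eq
... | true = refl
... | false = ⊥-elim (subst T eq (ℕ.≡⇒≡ᵇ y x e))

≡ᵇ-false : ∀ y x → y ≢ x → (y ℕ.≡ᵇ x) ≡ false
≡ᵇ-false y x n with y ℕ.≡ᵇ x in eq
... | true = ⊥-elim (n (ℕ.≡ᵇ⇒≡ y x (subst T (sym eq) tt)))
... | false = refl

rn-≡ : ∀ x x' → rn x x' x ≡ x'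
rn-≡ x x' rewrite ≡ᵇ-true x x refl = refl

rn-≢ : ∀ {x x' z} → z ≢ x → rn x x' z ≡ z
rn-≢ {x} {x'} {z} n rewrite ≡ᵇ-false z x n = refl

rn-inj : ∀ {x x' a b} → x' ≢ a → x' ≢ b → rn x x' a ≡ rn x x' b → a ≡ b
rn-inj {x} {x'} {a} {b} na nb e with a ≟ x | b ≟ x
... | yes refl | yes refl = refl
... | yes refl | no m = ⊥-elim (nb (≡-trans (sym (rn-≡ x x')) (≡-trans e (rn-≢ m))))
... | no m | yes refl = ⊥-elim (na (≡-trans (sym (rn-≡ x x')) (≡-trans (sym e) (rn-≢ m))))
... | no m | no m' = ≡-trans (sym (rn-≢ m)) (≡-trans e (rn-≢ m'))

rn-inv : ∀ {c y z} → c ≢ z → rn c y (rn y c z) ≡ z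
rn-inv {c} {y} {z} n with z ≟ y
... | yes refl rewrite rn-≡ z c = rn-≡ c z
... | no m rewrite rn-≢ {y} {c} m = rn-≢ (λ e → n (sym e))

renΓ : Name → Name → Sequent → Sequent
renΓ x x' = map (λ p → rn x x' (proj₁ p) , proj₂ p)

renΓ-++ : ∀ x x' Γ Δ → renΓ x x' (Γ ++ Δ) ≡ renΓ x x' Γ ++ renΓ x x' Δ
renΓ-++ x x' Γ Δ = map-++ _ Γ Δ

renΓ-fresh : ∀ {x x'} Γ → x ∉ names Γ → renΓ x x' Γ ≡ Γ
renΓ-fresh [] n = refl
renΓ-fresh ((a , A) ∷ Γ) n = cong₂ _∷_ (cong (_, A) (rn-≢ (λ e → n (here (sym e))))) (renΓ-fresh Γ (λ i → n (there i)))

names-renΓ⁻ : ∀ {x x' w} Γ → w ∈ names (renΓ x x' Γ) → ∃ λ v → v ∈ names Γ × w ≡ rn x x' v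
names-renΓ⁻ ((a , A) ∷ Γ) (here e) = a , here refl , e
names-renΓ⁻ ((a , A) ∷ Γ) (there i) with names-renΓ⁻ Γ i
... | v , j , e = v , there j , e

Unique-renΓ : ∀ {x x'} Γ → Unique (names Γ) → x' ∉ names Γ → Unique (names (renΓ x x' Γ))
Unique-renΓ [] u n = []
Unique-renΓ {x} {x'} ((a , A) ∷ Γ) u n =
  Unique-∷ go (Unique-renΓ Γ (Unique-tail u) (λ i → n (there i)))
  where
  go : rn x x' a ∉ names (renΓ x x' Γ)
  go i with names-renΓ⁻ Γ i
  ... | v , j , e = Unique-head u (subst (_∈ names Γ) (sym (rn-inj (λ e' → n (here e')) (λ e' → n (there (subst (_∈ names Γ) (sym e') j))) e)) j)

bound : Term → List Name
bound (ax A x y) = []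
bound (cut A x P Q) = x ∷ bound P ++ bound Q
bound (tens x y P Q) = y ∷ bound P ++ bound Q
bound (par x y P) = y ∷ bound P
bound (one x) = []
bound (bot x P) = bound P
bound (wth x P Q) = bound P ++ bound Q
bound (plus₁ x B P) = bound P
bound (plus₂ x A P) = bound P
bound (top x Γ) = []

ren-fresh : ∀ P {x x'} → x ∉ allNames P → ren x x' P ≡ P
ren-fresh (ax A a b) {x} {x'} n = cong₂ (ax A) (rn-≢ (≢-sym (∉∷⁻ʰ n))) (rn-≢ (≢-sym (∉∷⁻ʰ (∉∷⁻ᵗ n))))
ren-fresh (cut A y P Q) {x} {x'} n rewrite ≡ᵇ-false y x (≢-sym (∉∷⁻ʰ n)) =
  cong₂ (cut A y) (ren-fresh P (∉++⁻ˡ (allNames P) (∉∷⁻ᵗ n))) (ren-fresh Q (∉++⁻ʳ (allNames P) (∉∷⁻ᵗ n)))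
ren-fresh (tens z y P Q) {x} {x'} n rewrite ≡ᵇ-false y x (≢-sym (∉∷⁻ʰ (∉∷⁻ᵗ n))) | rn-≢ {x} {x'} (≢-sym (∉∷⁻ʰ n)) =
  cong₂ (tens z y) (ren-fresh P (∉++⁻ˡ (allNames P) (∉∷⁻ᵗ (∉∷⁻ᵗ n)))) (ren-fresh Q (∉++⁻ʳ (allNames P) (∉∷⁻ᵗ (∉∷⁻ᵗ n))))
ren-fresh (par z y P) {x} {x'} n rewrite ≡ᵇ-false y x (≢-sym (∉∷⁻ʰ (∉∷⁻ᵗ n))) | rn-≢ {x} {x'} (≢-sym (∉∷⁻ʰ n)) =
  cong (par z y) (ren-fresh P (∉∷⁻ᵗ (∉∷⁻ᵗ n)))
ren-fresh (one z) {x} {x'} n = cong one (rn-≢ (≢-sym (∉∷⁻ʰ n)))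
ren-fresh (bot z P) {x} {x'} n = cong₂ bot (rn-≢ (≢-sym (∉∷⁻ʰ n))) (ren-fresh P (∉∷⁻ᵗ n))
ren-fresh (wth z P Q) {x} {x'} n rewrite rn-≢ {x} {x'} (≢-sym (∉∷⁻ʰ n)) =
  cong₂ (wth z) (ren-fresh P (∉++⁻ˡ (allNames P) (∉∷⁻ᵗ n))) (ren-fresh Q (∉++⁻ʳ (allNames P) (∉∷⁻ᵗ n)))
ren-fresh (plus₁ z B P) {x} {x'} n rewrite rn-≢ {x} {x'} (≢-sym (∉∷⁻ʰ n)) = cong (plus₁ z B) (ren-fresh P (∉∷⁻ᵗ n))
ren-fresh (plus₂ z B P) {x} {x'} n rewrite rn-≢ {x} {x'} (≢-sym (∉∷⁻ʰ n)) = cong (plus₂ z B) (ren-fresh P (∉∷⁻ᵗ n))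
ren-fresh (top z Γ) {x} {x'} n = cong₂ top (rn-≢ (≢-sym (∉∷⁻ʰ n))) (renΓ-fresh Γ (∉∷⁻ᵗ n))

renΓ-inv : ∀ {c y} Γ → c ∉ names Γ → renΓ c y (renΓ y c Γ) ≡ Γ
renΓ-inv [] n = refl
renΓ-inv ((a , A) ∷ Γ) n = cong₂ _∷_ (cong (_, A) (rn-inv (∉∷⁻ʰ n))) (renΓ-inv Γ (∉∷⁻ᵗ n))

ren-inv : ∀ R {y c} → c ∉ allNames R → ren c y (ren y c R) ≡ R
ren-inv (ax A a b) n = cong₂ (ax A) (rn-inv (∉∷⁻ʰ n)) (rn-inv (∉∷⁻ʰ (∉∷⁻ᵗ n)))
ren-inv (cut A v P Q) {y} {c} n with v ≟ y
... | yes refl rewrite ≡ᵇ-true v v refl | ≡ᵇ-false v c (≢-sym (∉∷⁻ʰ n)) =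
  cong₂ (cut A v) (ren-fresh P (∉++⁻ˡ (allNames P) (∉∷⁻ᵗ n))) (ren-fresh Q (∉++⁻ʳ (allNames P) (∉∷⁻ᵗ n)))
... | no m rewrite ≡ᵇ-false v y m | ≡ᵇ-false v c (≢-sym (∉∷⁻ʰ n)) =
  cong₂ (cut A v) (ren-inv P (∉++⁻ˡ (allNames P) (∉∷⁻ᵗ n))) (ren-inv Q (∉++⁻ʳ (allNames P) (∉∷⁻ᵗ n)))
ren-inv (tens z v P Q) {y} {c} n with v ≟ y
... | yes refl rewrite ≡ᵇ-true v v refl | ≡ᵇ-false v c (≢-sym (∉∷⁻ʰ (∉∷⁻ᵗ n))) | rn-inv {c} {v} {z} (∉∷⁻ʰ n) =
  cong₂ (tens z v) (ren-fresh P (∉++⁻ˡ (allNames P) (∉∷⁻ᵗ (∉∷⁻ᵗ n)))) (ren-inv Q (∉++⁻ʳ (allNames P) (∉∷⁻ᵗ (∉∷⁻ᵗ n))))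
... | no m rewrite ≡ᵇ-false v y m | ≡ᵇ-false v c (≢-sym (∉∷⁻ʰ (∉∷⁻ᵗ n))) | rn-inv {c} {y} {z} (∉∷⁻ʰ n) =
  cong₂ (tens z v) (ren-inv P (∉++⁻ˡ (allNames P) (∉∷⁻ᵗ (∉∷⁻ᵗ n)))) (ren-inv Q (∉++⁻ʳ (allNames P) (∉∷⁻ᵗ (∉∷⁻ᵗ n))))
ren-inv (par z v P) {y} {c} n with v ≟ y
... | yes refl rewrite ≡ᵇ-true v v refl | ≡ᵇ-false v c (≢-sym (∉∷⁻ʰ (∉∷⁻ᵗ n))) | rn-inv {c} {v} {z} (∉∷⁻ʰ n) =
  cong (par z v) (ren-fresh P (∉∷⁻ᵗ (∉∷⁻ᵗ n)))
... | no m rewrite ≡ᵇ-false v y m | ≡ᵇ-false v c (≢-sym (∉∷⁻ʰ (∉∷⁻ᵗ n))) | rn-inv {c} {y} {z} (∉∷⁻ʰ n) =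
  cong (par z v) (ren-inv P (∉∷⁻ᵗ (∉∷⁻ᵗ n)))
ren-inv (one z) n = cong one (rn-inv (∉∷⁻ʰ n))
ren-inv (bot z P) n = cong₂ bot (rn-inv (∉∷⁻ʰ n)) (ren-inv P (∉∷⁻ᵗ n))
ren-inv (wth z P Q) {y} {c} n rewrite rn-inv {c} {y} {z} (∉∷⁻ʰ n) =
  cong₂ (wth z) (ren-inv P (∉++⁻ˡ (allNames P) (∉∷⁻ᵗ n))) (ren-inv Q (∉++⁻ʳ (allNames P) (∉∷⁻ᵗ n)))
ren-inv (plus₁ z B P) {y} {c} n rewrite rn-inv {c} {y} {z} (∉∷⁻ʰ n) = cong (plus₁ z B) (ren-inv P (∉∷⁻ᵗ n))
ren-inv (plus₂ z B P) {y} {c} n rewrite rn-inv {c} {y} {z} (∉∷⁻ʰ n) = cong (plus₂ z B) (ren-inv P (∉∷⁻ᵗ n))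
ren-inv (top z Γ) n = cong₂ top (rn-inv (∉∷⁻ʰ n)) (renΓ-inv Γ (∉∷⁻ᵗ n))

≢-rn : ∀ {x x' z a} → z ≢ a → z ≢ x' → z ≢ rn x x' a
≢-rn {x} {x'} {z} {a} n m with a ≟ x
... | yes refl rewrite rn-≡ a x' = m
... | no k rewrite rn-≢ {x} {x'} k = n

≢-rn-self : ∀ {y c a} → y ≢ c → y ≢ rn y c a
≢-rn-self {y} {c} {a} n with a ≟ y
... | yes refl rewrite rn-≡ a c = n
... | no k rewrite rn-≢ {y} {c} k = ≢-sym k

∉names-renΓ : ∀ {x x' z} Γ → z ∉ names Γ → z ≢ x' → z ∉ names (renΓ x x' Γ)
∉names-renΓ Γ n m i with names-renΓ⁻ Γ i
... | v , j , e = ≢-rn (λ e' → n (subst (_∈ names Γ) (sym e') j)) m e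

∉allNames-ren : ∀ P {x x' z} → z ∉ allNames P → z ≢ x' → z ∉ allNames (ren x x' P)
∉allNames-ren (ax A a b) n m = ∉∷⁺ (≢-rn (∉∷⁻ʰ n) m) (∉∷⁺ (≢-rn (∉∷⁻ʰ (∉∷⁻ᵗ n)) m) (λ ()))
∉allNames-ren (cut A y P Q) {x} n m with y ≟ x
... | yes refl rewrite ≡ᵇ-true y y refl = n
... | no k rewrite ≡ᵇ-false y x k = ∉∷⁺ (∉∷⁻ʰ n) (∉++⁺ (allNames (ren x _ P)) (∉allNames-ren P (∉++⁻ˡ (allNames P) (∉∷⁻ᵗ n)) m) (∉allNames-ren Q (∉++⁻ʳ (allNames P) (∉∷⁻ᵗ n)) m))
∉allNames-ren (tens z y P Q) {x} n m with y ≟ x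
... | yes refl rewrite ≡ᵇ-true y y refl = ∉∷⁺ (≢-rn (∉∷⁻ʰ n) m) (∉∷⁺ (∉∷⁻ʰ (∉∷⁻ᵗ n)) (∉++⁺ (allNames P) (∉++⁻ˡ (allNames P) (∉∷⁻ᵗ (∉∷⁻ᵗ n))) (∉allNames-ren Q (∉++⁻ʳ (allNames P) (∉∷⁻ᵗ (∉∷⁻ᵗ n))) m)))
... | no k rewrite ≡ᵇ-false y x k = ∉∷⁺ (≢-rn (∉∷⁻ʰ n) m) (∉∷⁺ (∉∷⁻ʰ (∉∷⁻ᵗ n)) (∉++⁺ (allNames (ren x _ P)) (∉allNames-ren P (∉++⁻ˡ (allNames P) (∉∷⁻ᵗ (∉∷⁻ᵗ n))) m) (∉allNames-ren Q (∉++⁻ʳ (allNames P) (∉∷⁻ᵗ (∉∷⁻ᵗ n))) m)))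
∉allNames-ren (par z y P) {x} n m with y ≟ x
... | yes refl rewrite ≡ᵇ-true y y refl = ∉∷⁺ (≢-rn (∉∷⁻ʰ n) m) (∉∷⁺ (∉∷⁻ʰ (∉∷⁻ᵗ n)) (∉∷⁻ᵗ (∉∷⁻ᵗ n)))
... | no k rewrite ≡ᵇ-false y x k = ∉∷⁺ (≢-rn (∉∷⁻ʰ n) m) (∉∷⁺ (∉∷⁻ʰ (∉∷⁻ᵗ n)) (∉allNames-ren P (∉∷⁻ᵗ (∉∷⁻ᵗ n)) m))
∉allNames-ren (one z) n m = ∉∷⁺ (≢-rn (∉∷⁻ʰ n) m) (λ ())
∉allNames-ren (bot z P) n m = ∉∷⁺ (≢-rn (∉∷⁻ʰ n) m) (∉allNames-ren P (∉∷⁻ᵗ n) m)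
∉allNames-ren (wth z P Q) {x} {x'} n m = ∉∷⁺ (≢-rn (∉∷⁻ʰ n) m) (∉++⁺ (allNames (ren x x' P)) (∉allNames-ren P (∉++⁻ˡ (allNames P) (∉∷⁻ᵗ n)) m) (∉allNames-ren Q (∉++⁻ʳ (allNames P) (∉∷⁻ᵗ n)) m))
∉allNames-ren (plus₁ z B P) n m = ∉∷⁺ (≢-rn (∉∷⁻ʰ n) m) (∉allNames-ren P (∉∷⁻ᵗ n) m)
∉allNames-ren (plus₂ z B P) n m = ∉∷⁺ (≢-rn (∉∷⁻ʰ n) m) (∉allNames-ren P (∉∷⁻ᵗ n) m)
∉allNames-ren (top z Γ) n m = ∉∷⁺ (≢-rn (∉∷⁻ʰ n) m) (∉names-renΓ Γ (∉∷⁻ᵗ n) m)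

∉names-renΓ-self : ∀ {y c} Γ → y ≢ c → y ∉ names (renΓ y c Γ)
∉names-renΓ-self Γ n i with names-renΓ⁻ Γ i
... | v , j , e = ≢-rn-self {a = v} n e

∉allNames-ren-self : ∀ R {y c} → y ∉ bound R → y ≢ c → y ∉ allNames (ren y c R)
∉allNames-ren-self (ax A a b) n m = ∉∷⁺ (≢-rn-self {a = a} m) (∉∷⁺ (≢-rn-self {a = b} m) (λ ()))
∉allNames-ren-self (cut A v P Q) {y} {c} n m rewrite ≡ᵇ-false v y (≢-sym (∉∷⁻ʰ n)) =
  ∉∷⁺ (∉∷⁻ʰ n) (∉++⁺ (allNames (ren y c P)) (∉allNames-ren-self P (∉++⁻ˡ (bound P) (∉∷⁻ᵗ n)) m) (∉allNames-ren-self Q (∉++⁻ʳ (bound P) (∉∷⁻ᵗ n)) m))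
∉allNames-ren-self (tens z v P Q) {y} {c} n m rewrite ≡ᵇ-false v y (≢-sym (∉∷⁻ʰ n)) =
  ∉∷⁺ (≢-rn-self {a = z} m) (∉∷⁺ (∉∷⁻ʰ n) (∉++⁺ (allNames (ren y c P)) (∉allNames-ren-self P (∉++⁻ˡ (bound P) (∉∷⁻ᵗ n)) m) (∉allNames-ren-self Q (∉++⁻ʳ (bound P) (∉∷⁻ᵗ n)) m)))
∉allNames-ren-self (par z v P) {y} {c} n m rewrite ≡ᵇ-false v y (≢-sym (∉∷⁻ʰ n)) =
  ∉∷⁺ (≢-rn-self {a = z} m) (∉∷⁺ (∉∷⁻ʰ n) (∉allNames-ren-self P (∉∷⁻ᵗ n) m))
∉allNames-ren-self (one z) n m = ∉∷⁺ (≢-rn-self {a = z} m) (λ ())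
∉allNames-ren-self (bot z P) n m = ∉∷⁺ (≢-rn-self {a = z} m) (∉allNames-ren-self P n m)
∉allNames-ren-self (wth z P Q) {y} {c} n m = ∉∷⁺ (≢-rn-self {a = z} m) (∉++⁺ (allNames (ren y c P)) (∉allNames-ren-self P (∉++⁻ˡ (bound P) n) m) (∉allNames-ren-self Q (∉++⁻ʳ (bound P) n) m))
∉allNames-ren-self (plus₁ z B P) n m = ∉∷⁺ (≢-rn-self {a = z} m) (∉allNames-ren-self P n m)
∉allNames-ren-self (plus₂ z B P) n m = ∉∷⁺ (≢-rn-self {a = z} m) (∉allNames-ren-self P n m)
∉allNames-ren-self (top z Γ) n m = ∉∷⁺ (≢-rn-self {a = z} m) (∉names-renΓ-self Γ m)

bound-ren : ∀ P {x x'} → bound (ren x x' P) ≡ bound P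
bound-ren (ax A a b) = refl
bound-ren (cut A y P Q) {x} with y ≟ x
... | yes refl rewrite ≡ᵇ-true y y refl = refl
... | no k rewrite ≡ᵇ-false y x k = cong (y ∷_) (cong₂ _++_ (bound-ren P) (bound-ren Q))
bound-ren (tens z y P Q) {x} with y ≟ x
... | yes refl rewrite ≡ᵇ-true y y refl = cong (y ∷_) (cong (bound P ++_) (bound-ren Q))
... | no k rewrite ≡ᵇ-false y x k = cong (y ∷_) (cong₂ _++_ (bound-ren P) (bound-ren Q))
bound-ren (par z y P) {x} with y ≟ x
... | yes refl rewrite ≡ᵇ-true y y refl = refl
... | no k rewrite ≡ᵇ-false y x k = cong (y ∷_) (bound-ren P)
bound-ren (one z) = refl
bound-ren (bot z P) = bound-ren P
bound-ren (wth z P Q) = cong₂ _++_ (bound-ren P) (bound-ren Q)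
bound-ren (plus₁ z B P) = bound-ren P
bound-ren (plus₂ z B P) = bound-ren P
bound-ren (top z Γ) = refl

⊢cut-name∉ : ∀ {P Q y A B Γ Δ} → P ⊢ (y , A) ∷ Γ → Q ⊢ (y , B) ∷ Δ → y ∉ names (Γ ++ Δ)
⊢cut-name∉ {Γ = Γ} d e i with names-++⁻ Γ i
... | inj₁ j = Unique-head (⊢-Unique d) j
... | inj₂ j = Unique-head (⊢-Unique e) j

⊢ren : ∀ {P Γ x x'} → P ⊢ Γ → x' ∉ allNames P → ren x x' P ⊢ renΓ x x' Γ
⊢ren (⊢ex p d) n = ⊢ex (↭-map⁺ _ p) (⊢ren d n)
⊢ren {x = x} {x'} (⊢ax {A} {a} {b} ab) n = ⊢ax (λ e → ab (rn-inj (∉∷⁻ʰ n) (∉∷⁻ʰ (∉∷⁻ᵗ n)) e))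
⊢ren {x = x} {x'} (⊢cut {A} {y} {P} {Q} {Γ} {Δ} d e u) n with y ≟ x
... | yes refl rewrite ≡ᵇ-true y y refl | renΓ-fresh {y} {x'} (Γ ++ Δ) (⊢cut-name∉ d e) = ⊢cut d e u
... | no k rewrite ≡ᵇ-false y x k | renΓ-++ x x' Γ Δ =
   ⊢cut (subst (λ w → ren x x' P ⊢ (w , A) ∷ renΓ x x' Γ) (rn-≢ k) (⊢ren d (∉++⁻ˡ (allNames P) (∉∷⁻ᵗ n))))
        (subst (λ w → ren x x' Q ⊢ (w , dual A) ∷ renΓ x x' Δ) (rn-≢ k) (⊢ren e (∉++⁻ʳ (allNames P) (∉∷⁻ᵗ n))))
        (subst (λ L → Unique (names L)) (renΓ-++ x x' Γ Δ) (Unique-renΓ (Γ ++ Δ) u (∉allNames⇒∉names (⊢cut d e u) n)))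
⊢ren {x = x} {x'} (⊢tens {A} {B} {z} {y} {P} {Q} {Γ} {Δ} d e u) n with y ≟ x
... | yes refl rewrite ≡ᵇ-true y y refl =
  subst (λ L → tens (rn y x' z) y P (ren y x' Q) ⊢ L) (sym eqL)
    (⊢tens d (⊢ren e (∉++⁻ʳ (allNames P) (∉∷⁻ᵗ (∉∷⁻ᵗ n))))
       (subst (λ L → Unique (names L)) eqL (Unique-renΓ {y} {x'} ((z , A ⊗ B) ∷ Γ ++ Δ) u (∉allNames⇒∉names (⊢tens d e u) n))))
  where
  eqL : renΓ y x' ((z , A ⊗ B) ∷ Γ ++ Δ) ≡ (rn y x' z , A ⊗ B) ∷ Γ ++ renΓ y x' Δ
  eqL = cong ((rn y x' z , A ⊗ B) ∷_) (≡-trans (renΓ-++ y x' Γ Δ) (cong (_++ renΓ y x' Δ) (renΓ-fresh Γ (Unique-head (⊢-Unique d)))))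
... | no k rewrite ≡ᵇ-false y x k =
  subst (λ L → tens (rn x x' z) y (ren x x' P) (ren x x' Q) ⊢ L) (sym eqL)
    (⊢tens (subst (λ w → ren x x' P ⊢ (w , A) ∷ renΓ x x' Γ) (rn-≢ k) (⊢ren d (∉++⁻ˡ (allNames P) (∉∷⁻ᵗ (∉∷⁻ᵗ n)))))
       (⊢ren e (∉++⁻ʳ (allNames P) (∉∷⁻ᵗ (∉∷⁻ᵗ n))))
       (subst (λ L → Unique (names L)) eqL (Unique-renΓ {x} {x'} ((z , A ⊗ B) ∷ Γ ++ Δ) u (∉allNames⇒∉names (⊢tens d e u) n))))
  where
  eqL : renΓ x x' ((z , A ⊗ B) ∷ Γ ++ Δ) ≡ (rn x x' z , A ⊗ B) ∷ renΓ x x' Γ ++ renΓ x x' Δ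
  eqL = cong ((rn x x' z , A ⊗ B) ∷_) (renΓ-++ x x' Γ Δ)
⊢ren {x = x} {x'} (⊢par {A} {B} {z} {y} {P} {Γ} d) n with y ≟ x
... | yes refl rewrite ≡ᵇ-true y y refl | rn-≢ {y} {x'} {z} (≢-sym (∉∷⁻ʰ (Unique-head (⊢-Unique d))))
                 | renΓ-fresh {y} {x'} Γ (∉∷⁻ᵗ (Unique-head (⊢-Unique d))) = ⊢par d
... | no k rewrite ≡ᵇ-false y x k =
  ⊢par (subst (λ w → ren x x' P ⊢ (w , A) ∷ (rn x x' z , B) ∷ renΓ x x' Γ) (rn-≢ k) (⊢ren d (∉∷⁻ᵗ (∉∷⁻ᵗ n))))
⊢ren ⊢one n = ⊢one
⊢ren {x = x} {x'} (⊢bot {z} {P} {Γ} d m) n =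
  ⊢bot (⊢ren d (∉∷⁻ᵗ n)) (Unique-head (Unique-renΓ ((z , ⊥ᶠ) ∷ Γ) (Unique-∷ m (⊢-Unique d)) (∉allNames⇒∉names (⊢bot d m) n)))
⊢ren {P = wth z P Q} (⊢wth d e) n = ⊢wth (⊢ren d (∉++⁻ˡ (allNames P) (∉∷⁻ᵗ n))) (⊢ren e (∉++⁻ʳ (allNames P) (∉∷⁻ᵗ n)))
⊢ren (⊢plus₁ d) n = ⊢plus₁ (⊢ren d (∉∷⁻ᵗ n))
⊢ren (⊢plus₂ d) n = ⊢plus₂ (⊢ren d (∉∷⁻ᵗ n))
⊢ren {x = x} {x'} (⊢top {z} {Γ} u) n = ⊢top (Unique-renΓ ((z , ⊤ᶠ) ∷ Γ) u (∉allNames⇒∉names (⊢top u) n))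

infix 4 _≈⟨_⟩_
infixr 5 _▸_

data _≈⟨_⟩_ : Term → Sequent → Term → Set where
  step   : ∀ {P Q Γ} → P ⊢ Γ → Q ⊢ Γ → Cong RootStep P Q → P ≈⟨ Γ ⟩ Q
  ≈-refl : ∀ {P Γ} → P ≈⟨ Γ ⟩ P
  ≈-sym  : ∀ {P Q Γ} → P ≈⟨ Γ ⟩ Q → Q ≈⟨ Γ ⟩ P
  _▸_    : ∀ {P Q R Γ} → P ≈⟨ Γ ⟩ Q → Q ≈⟨ Γ ⟩ R → P ≈⟨ Γ ⟩ R

≈⇒=β : ∀ {Γ P Q} → P ≈⟨ Γ ⟩ Q → P =β Q
≈⇒=β (step d e s) = =β-step d e s
≈⇒=β ≈-refl = =β-refl
≈⇒=β (≈-sym c) = =β-sym (≈⇒=β c)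
≈⇒=β (c ▸ c') = =β-trans (≈⇒=β c) (≈⇒=β c')

≈-cong : ∀ {Γ Δ} (K : Term → Term) → (∀ {P Q} → Cong RootStep P Q → Cong RootStep (K P) (K Q)) →
         (∀ {P} → P ⊢ Γ → K P ⊢ Δ) → ∀ {P Q} → P ≈⟨ Γ ⟩ Q → K P ≈⟨ Δ ⟩ K Q
≈-cong K kc kt (step d e s) = step (kt d) (kt e) (kc s)
≈-cong K kc kt ≈-refl = ≈-refl
≈-cong K kc kt (≈-sym c) = ≈-sym (≈-cong K kc kt c)
≈-cong K kc kt (c ▸ c') = ≈-cong K kc kt c ▸ ≈-cong K kc kt c'

≈-resp-↭ : ∀ {Γ Δ P Q} → Γ ↭ Δ → P ≈⟨ Γ ⟩ Q → P ≈⟨ Δ ⟩ Q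
≈-resp-↭ p = ≈-cong (λ x → x) (λ s → s) (⊢ex p)

β-step : ∀ {Γ P Q} → P ⊢ Γ → Q ⊢ Γ → CutStep P Q → P ≈⟨ Γ ⟩ Q
β-step d e s = step d e (root (β-root s))

α-step : ∀ {Γ P Q} → P ⊢ Γ → Q ⊢ Γ → Alpha P Q → P ≈⟨ Γ ⟩ Q
α-step d e s = step d e (root (α-root s))

≈-reflexive : ∀ {Γ P Q} → P ≡ Q → P ≈⟨ Γ ⟩ Q
≈-reflexive refl = ≈-refl

-- Renaming bound names apart

Avoids : List Name → Term → Set
Avoids S R = ∀ {z} → z ∈ S → z ∉ bound R

-- Factorising a proof through an η-expansion renames the active names of a rule
-- into fresh ones and back; this is only capture-free when those names are not
-- bound inside the proof.
record Freshened (S : List Name) (R : Term) (Γ : Sequent) : Set where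
  constructor freshened
  field
    R̃ : Term
    R≈R̃ : R ≈⟨ Γ ⟩ R̃
    ⊢R̃ : R̃ ⊢ Γ
    R̃-avoids : Avoids S R̃

⊢ren-head : ∀ {P y y' A Γ} → P ⊢ (y , A) ∷ Γ → y' ∉ allNames P → ren y y' P ⊢ (y' , A) ∷ Γ
⊢ren-head {P} {y} {y'} {A} {Γ} d n =
  subst (λ L → ren y y' P ⊢ L) (cong₂ _∷_ (cong (_, A) (rn-≡ y y')) (renΓ-fresh Γ (Unique-head (⊢-Unique d)))) (⊢ren d n)

freshFor : List Name → Term → Name
freshFor S P = fresh (S ++ allNames P)

freshFor∉allNames : ∀ S P → freshFor S P ∉ allNames P
freshFor∉allNames S P = ∉++⁻ʳ S (fresh∉ (S ++ allNames P))

freshFor-≢ : ∀ {S z} P → z ∈ S → z ≢ freshFor S P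
freshFor-≢ {S} P i refl = fresh∉ (S ++ allNames P) (∈-++⁺ˡ i)

freshen : ∀ S R {Γ} → CutFree R → R ⊢ Γ → Freshened S R Γ
freshen S (ax A x y) c d = freshened _ ≈-refl d (λ _ ())
freshen S (cut A x P Q) () d
freshen S (one x) c d = freshened _ ≈-refl d (λ _ ())
freshen S (top x Δ) c d = freshened _ ≈-refl d (λ _ ())
freshen S (bot x P) c d with inv-bot d
... | Γ₁ , dP , n , q with freshen S P c dP
... | freshened P̃ P≈ dP̃ av =
  freshened (bot x P̃) (≈-cong (bot x) botᶜ (λ e → ⊢ex q (⊢bot e n)) P≈) (⊢ex q (⊢bot dP̃ n)) av
freshen S (plus₁ x B P) c d with inv-plus₁ d
... | A , Γ₁ , dP , q with freshen S P c dP
... | freshened P̃ P≈ dP̃ av =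
  freshened (plus₁ x B P̃) (≈-cong (plus₁ x B) plus₁ᶜ (λ e → ⊢ex q (⊢plus₁ e)) P≈) (⊢ex q (⊢plus₁ dP̃)) av
freshen S (plus₂ x A P) c d with inv-plus₂ d
... | B , Γ₁ , dP , q with freshen S P c dP
... | freshened P̃ P≈ dP̃ av =
  freshened (plus₂ x A P̃) (≈-cong (plus₂ x A) plus₂ᶜ (λ e → ⊢ex q (⊢plus₂ e)) P≈) (⊢ex q (⊢plus₂ dP̃)) av
freshen S (wth x P Q) (cP , cQ) d with inv-wth d
... | A , B , Γ₁ , dP , dQ , q with freshen S P cP dP | freshen S Q cQ dQ
... | freshened P̃ P≈ dP̃ av | freshened Q̃ Q≈ dQ̃ av' =
  freshened (wth x P̃ Q̃)
    (≈-cong (λ t → wth x t Q) wthˡ (λ e → ⊢ex q (⊢wth e dQ)) P≈ ▸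
     ≈-cong (wth x P̃) wthʳ (λ e → ⊢ex q (⊢wth dP̃ e)) Q≈)
    (⊢ex q (⊢wth dP̃ dQ̃)) (λ i → ∉++⁺ (bound P̃) (av i) (av' i))
freshen S (par x y P) c d with inv-par d
... | A , B , Γ₁ , dP , q with freshen S P c dP
... | freshened P̃ P≈ dP̃ av =
  freshened (par x y' (ren y y' P̃))
    (≈-cong (par x y) parᶜ (λ e → ⊢ex q (⊢par e)) P≈ ▸
     α-step (⊢ex q (⊢par dP̃)) ⊢P̃′ (α-par (freshFor∉allNames S P̃)))
    ⊢P̃′ (λ i → ∉∷⁺ (freshFor-≢ P̃ i) (subst (_ ∉_) (sym (bound-ren P̃)) (av i)))
  where
  y' = freshFor S P̃
  ⊢P̃′ = ⊢ex q (⊢par (⊢ren-head dP̃ (freshFor∉allNames S P̃)))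
freshen S (tens x y P Q) (cP , cQ) d with inv-tens d
... | A , B , Γ₁ , Δ₁ , dP , dQ , u , q with freshen S P cP dP | freshen S Q cQ dQ
... | freshened P̃ P≈ dP̃ av | freshened Q̃ Q≈ dQ̃ av' =
  freshened (tens x y' (ren y y' P̃) Q̃)
    (≈-cong (λ t → tens x y t Q) tensˡ (λ e → ⊢ex q (⊢tens e dQ u)) P≈ ▸
     ≈-cong (tens x y P̃) tensʳ (λ e → ⊢ex q (⊢tens dP̃ e u)) Q≈ ▸
     α-step (⊢ex q (⊢tens dP̃ dQ̃ u)) ⊢T′ (α-tens (freshFor∉allNames S P̃)))
    ⊢T′ (λ i → ∉∷⁺ (freshFor-≢ P̃ i) (∉++⁺ (bound (ren y y' P̃)) (subst (_ ∉_) (sym (bound-ren P̃)) (av i)) (av' i)))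
  where
  y' = freshFor S P̃
  ⊢T′ = ⊢ex q (⊢tens (⊢ren-head dP̃ (freshFor∉allNames S P̃)) dQ̃ u)

-- The rule F takes the premise ⊢ I, Γ in its hole to ⊢ O, Γ; for a ⊗-rule, O also
-- contains the context of the side premise.
data FrameTyping : Frame → Sequent → Sequent → Set where
  ⊢parF : ∀ {x y A B} → FrameTyping (parF x y) ((y , A) ∷ (x , B) ∷ []) ((x , A ⅋ B) ∷ [])
  ⊢botF : ∀ {x} → FrameTyping (botF x) [] ((x , ⊥ᶠ) ∷ [])
  ⊢plus₁F : ∀ {x A B} → FrameTyping (plus₁F x B) ((x , A) ∷ []) ((x , A ⊕ B) ∷ [])
  ⊢plus₂F : ∀ {x A B} → FrameTyping (plus₂F x A) ((x , B) ∷ []) ((x , A ⊕ B) ∷ [])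
  ⊢tensLF : ∀ {x y Q A B Δ} → Q ⊢ (x , B) ∷ Δ → FrameTyping (tensLF x y Q) ((y , A) ∷ []) ((x , A ⊗ B) ∷ Δ)
  ⊢tensRF : ∀ {x y P A B Γ} → P ⊢ (y , A) ∷ Γ → FrameTyping (tensRF x y P) ((x , B) ∷ []) ((x , A ⊗ B) ∷ Γ)

⊢plug : ∀ {F I O R Γ} → FrameTyping F I O → R ⊢ I ++ Γ → Unique (names (O ++ Γ)) → plug F R ⊢ O ++ Γ
⊢plug ⊢parF d u = ⊢par d
⊢plug ⊢botF d u = ⊢bot d (Unique-head u)
⊢plug ⊢plus₁F d u = ⊢plus₁ d
⊢plug ⊢plus₂F d u = ⊢plus₂ d
⊢plug {Γ = Γ} (⊢tensLF {x = x} {A = A} {B = B} {Δ = Δ} e) d u =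
  ⊢ex (prep _ (++-comm Γ Δ)) (⊢tens d e (Unique-resp-↭ (names-↭ (prep (x , A ⊗ B) (++-comm Δ Γ))) u))
⊢plug (⊢tensRF e) d u = ⊢tens e d u

⊢plug-head : ∀ {F I O E c X} → FrameTyping F I O → E ⊢ (c , X) ∷ I → Unique (names ((c , X) ∷ O)) →
  plug F E ⊢ (c , X) ∷ O
⊢plug-head {O = O} ft e u =
  ⊢ex (++-comm O _) (⊢plug ft (⊢ex (++-comm [ _ ] _) e) (Unique-names-resp-↭ (++-comm [ _ ] O) u))

plug-inv : ∀ F {R Δ} → plug F R ⊢ Δ → Σ[ I ∈ Sequent ] Σ[ O ∈ Sequent ] Σ[ Γ ∈ Sequent ]
  FrameTyping F I O × R ⊢ I ++ Γ × (O ++ Γ) ↭ Δ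
plug-inv (parF x y) d with inv-par d
... | A , B , Γ₁ , dP , q = _ , _ , _ , ⊢parF , dP , q
plug-inv (botF x) d with inv-bot d
... | Γ₁ , dP , n , q = _ , _ , _ , ⊢botF , dP , q
plug-inv (plus₁F x B) d with inv-plus₁ d
... | A , Γ₁ , dP , q = _ , _ , _ , ⊢plus₁F , dP , q
plug-inv (plus₂F x A) d with inv-plus₂ d
... | B , Γ₁ , dP , q = _ , _ , _ , ⊢plus₂F , dP , q
plug-inv (tensLF x y Q) d with inv-tens d
... | A , B , Γ₁ , Δ₁ , dP , dQ , u , q = _ , _ , Γ₁ , ⊢tensLF dQ , dP , trans (prep _ (++-comm Δ₁ Γ₁)) q
plug-inv (tensRF x y P) d with inv-tens d
... | A , B , Γ₁ , Δ₁ , dP , dQ , u , q = _ , _ , Δ₁ , ⊢tensRF dP , dQ , q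

hole-names : ∀ {F I O} → FrameTyping F I O → names I ≡ active F
hole-names ⊢parF = refl
hole-names ⊢botF = refl
hole-names ⊢plus₁F = refl
hole-names ⊢plus₂F = refl
hole-names (⊢tensLF _) = refl
hole-names (⊢tensRF _) = refl

principal-conclusion : ∀ {F I O} → FrameTyping F I O → Σ[ X ∈ Formula ] Σ[ Os ∈ Sequent ] O ≡ (principal F , X) ∷ Os
principal-conclusion ⊢parF = _ , _ , refl
principal-conclusion ⊢botF = _ , _ , refl
principal-conclusion ⊢plus₁F = _ , _ , refl
principal-conclusion ⊢plus₂F = _ , _ , refl
principal-conclusion (⊢tensLF _) = _ , _ , refl
principal-conclusion (⊢tensRF _) = _ , _ , refl

Cong-plug : ∀ {R} F {P Q} → Cong R P Q → Cong R (plug F P) (plug F Q)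
Cong-plug (parF x y) s = parᶜ s
Cong-plug (botF x) s = botᶜ s
Cong-plug (plus₁F x B) s = plus₁ᶜ s
Cong-plug (plus₂F x A) s = plus₂ᶜ s
Cong-plug (tensLF x y Q) s = tensˡ s
Cong-plug (tensRF x y P) s = tensʳ s

record CutCommutes (F : Frame) (c : Name) (hole other : Term) : Set where
  constructor mkCC
  field
    principal≢cut : principal F ≢ c
    cut∉binders : c ∉ binders F
    cut∈hole : c ∈ fv hole
    binders∉other : ∀ {b} → b ∈ binders F → b ∉ fv other
    principal∉other : principal F ∉ fv other

open CutCommutes

cut-plugˡ : ∀ F {A c P Q} → CutCommutes F c P Q → CutStep (cut A c (plug F P) Q) (plug F (cut A c P Q))
cut-plugˡ (parF x y) cc = c-parˡ (principal≢cut cc) (λ e → cut∉binders cc (here (sym e))) (binders∉other cc (here refl))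
cut-plugˡ (botF x) cc = c-botˡ (principal≢cut cc)
cut-plugˡ (plus₁F x B) cc = c-plus₁ˡ (principal≢cut cc)
cut-plugˡ (plus₂F x A) cc = c-plus₂ˡ (principal≢cut cc)
cut-plugˡ (tensLF x y Q) cc =
  c-tensˡ₁ (principal≢cut cc) (λ e → cut∉binders cc (here (sym e))) (cut∈hole cc) (binders∉other cc (here refl))
cut-plugˡ (tensRF x y P) cc = c-tensˡ₂ (principal≢cut cc) (cut∈hole cc) (principal∉other cc)

cut-plugʳ : ∀ F {A c P Q} → CutCommutes F c Q P → CutStep (cut A c P (plug F Q)) (plug F (cut A c P Q))
cut-plugʳ (parF x y) cc = c-parʳ (principal≢cut cc) (λ e → cut∉binders cc (here (sym e))) (binders∉other cc (here refl))
cut-plugʳ (botF x) cc = c-botʳ (principal≢cut cc)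
cut-plugʳ (plus₁F x B) cc = c-plus₁ʳ (principal≢cut cc)
cut-plugʳ (plus₂F x A) cc = c-plus₂ʳ (principal≢cut cc)
cut-plugʳ (tensLF x y Q) cc =
  c-tensʳ₁ (principal≢cut cc) (λ e → cut∉binders cc (here (sym e))) (cut∈hole cc) (binders∉other cc (here refl))
cut-plugʳ (tensRF x y P) cc = c-tensʳ₂ (principal≢cut cc) (cut∈hole cc) (principal∉other cc)

principal∈frameNames : ∀ F → principal F ∈ frameNames F
principal∈frameNames (parF x y) = here refl
principal∈frameNames (botF x) = here refl
principal∈frameNames (plus₁F x B) = here refl
principal∈frameNames (plus₂F x A) = here refl
principal∈frameNames (tensLF x y Q) = here refl
principal∈frameNames (tensRF x y P) = here refl

binder∈frameNames : ∀ F {z} → z ∈ binders F → z ∈ frameNames F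
binder∈frameNames (parF x y) (here refl) = there (here refl)
binder∈frameNames (tensLF x y Q) (here refl) = there (here refl)

active-split : ∀ F {z} → z ∈ active F → z ≡ principal F ⊎ z ∈ binders F
active-split (parF x y) (here refl) = inj₂ (here refl)
active-split (parF x y) (there (here refl)) = inj₁ refl
active-split (plus₁F x B) (here refl) = inj₁ refl
active-split (plus₂F x A) (here refl) = inj₁ refl
active-split (tensLF x y Q) (here refl) = inj₂ (here refl)
active-split (tensRF x y P) (here refl) = inj₁ refl

active∈frameNames : ∀ F {z} → z ∈ active F → z ∈ frameNames F
active∈frameNames F i with active-split F i
... | inj₁ refl = principal∈frameNames F
... | inj₂ j = binder∈frameNames F j

binder∈active : ∀ F {z} → z ∈ binders F → z ∈ active F
binder∈active (parF x y) (here refl) = here refl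
binder∈active (tensLF x y Q) (here refl) = here refl

conclusion⊆frameNames : ∀ {F I O} → FrameTyping F I O → ∀ {z} → z ∈ names O → z ∈ frameNames F
conclusion⊆frameNames ⊢parF (here refl) = here refl
conclusion⊆frameNames ⊢botF (here refl) = here refl
conclusion⊆frameNames ⊢plus₁F (here refl) = here refl
conclusion⊆frameNames ⊢plus₂F (here refl) = here refl
conclusion⊆frameNames (⊢tensLF e) (here refl) = here refl
conclusion⊆frameNames (⊢tensLF e) (there i) = there (there (names⊆allNames e (there i)))
conclusion⊆frameNames (⊢tensRF e) (here refl) = here refl
conclusion⊆frameNames (⊢tensRF e) (there i) = there (there (names⊆allNames e (there i)))

FrameTyping-names : ∀ {F I O I' O'} → FrameTyping F I O → FrameTyping F I' O' → names O ↭ names O'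
FrameTyping-names ⊢parF ⊢parF = refl
FrameTyping-names ⊢botF ⊢botF = refl
FrameTyping-names ⊢plus₁F ⊢plus₁F = refl
FrameTyping-names ⊢plus₂F ⊢plus₂F = refl
FrameTyping-names {tensLF x y Q} (⊢tensLF e) (⊢tensLF e') = names-↭ (⊢-unique Q e e')
FrameTyping-names {tensRF x y P} (⊢tensRF e) (⊢tensRF e') = prep x (drop-∷ (names-↭ (⊢-unique P e e')))

hole∈active : ∀ {F I O} → FrameTyping F I O → ∀ {z} → z ∈ names I → z ∈ active F
hole∈active ft k = subst (_ ∈_) (hole-names ft) k

binder∈hole : ∀ {F I O} → FrameTyping F I O → ∀ {z} → z ∈ binders F → z ∈ names I
binder∈hole {F} ft k = subst (_ ∈_) (sym (hole-names ft)) (binder∈active F k)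

principal∈conclusion : ∀ {F I O} → FrameTyping F I O → principal F ∈ names O
principal∈conclusion ft with principal-conclusion ft
... | _ , _ , refl = here refl

CutFree-plug⁻ : ∀ F {W} → CutFree (plug F W) → CutFree W
CutFree-plug⁻ (parF x y) c = c
CutFree-plug⁻ (botF x) c = c
CutFree-plug⁻ (plus₁F x B) c = c
CutFree-plug⁻ (plus₂F x A) c = c
CutFree-plug⁻ (tensLF x y Q) c = proj₁ c
CutFree-plug⁻ (tensRF x y P) c = proj₂ c

-- Factorisation through η-expansions

data HoleShape : Sequent → Set where
  noHole : HoleShape []
  oneHole : ∀ {y A} → HoleShape ((y , A) ∷ [])
  twoHoles : ∀ {y A x B} → HoleShape ((y , A) ∷ (x , B) ∷ [])

holeShape : ∀ {F I O} → FrameTyping F I O → HoleShape I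
holeShape ⊢parF = twoHoles
holeShape ⊢botF = noHole
holeShape ⊢plus₁F = oneHole
holeShape ⊢plus₂F = oneHole
holeShape (⊢tensLF _) = oneHole
holeShape (⊢tensRF _) = oneHole

packedFormula : ∀ {I} → HoleShape I → Formula
packedFormula noHole = ⊥ᶠ
packedFormula (oneHole {A = A}) = A
packedFormula (twoHoles {A = A} {B = B}) = A ⅋ B

η-identity : ∀ {I} → HoleShape I → Name → Name → Term
η-identity noHole c d = one c
η-identity (oneHole {y} {A}) c d = ax A c y
η-identity (twoHoles {y} {A} {x} {B}) c d = tens c d (ax A d y) (ax B c x)

⊢η-identity : ∀ {I} (s : HoleShape I) {c d} → Unique (names I) → c ∉ names I → d ∉ c ∷ names I → η-identity s c d ⊢ (c , dual (packedFormula s)) ∷ I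
⊢η-identity noHole u n m = ⊢one
⊢η-identity oneHole u n m = ⊢ax (∉∷⁻ʰ n)
⊢η-identity twoHoles {c} {d} u n m =
  ⊢tens (⊢ax (∉∷⁻ʰ (∉∷⁻ᵗ m))) (⊢ax (∉∷⁻ʰ (∉∷⁻ᵗ n))) (Unique-∷ n u)

⊢ren-second : ∀ {P a x c A B Γ} → P ⊢ (a , A) ∷ (x , B) ∷ Γ → c ∉ allNames P → ren x c P ⊢ (a , A) ∷ (c , B) ∷ Γ
⊢ren-second {P} {a} {x} {c} {A} {B} {Γ} d n =
  subst (λ L → ren x c P ⊢ L)
    (cong₂ _∷_ (cong (_, A) (rn-≢ (∉∷⁻ʰ (Unique-head (⊢-Unique d)))))
      (cong₂ _∷_ (cong (_, B) (rn-≡ x c)) (renΓ-fresh Γ (Unique-head (Unique-tail (⊢-Unique d)))))) (⊢ren d n)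

-- R ⊢ I, Γ is β-equal to the cut of R₁ ⊢ c : X, Γ, in which I is packed into the
-- single formula c, against the η-expanded identity on I.
record Factorisation {I} (s : HoleShape I) (R : Term) (Γ : Sequent) (c d : Name) : Set where
  constructor factorisation
  field
    R₁ : Term
    ⊢R₁ : R₁ ⊢ (c , packedFormula s) ∷ Γ
    R≈cut : R ≈⟨ I ++ Γ ⟩ cut (packedFormula s) c R₁ (η-identity s c d)

factorise-bot : ∀ {Γ} R {c d} → R ⊢ Γ → c ∉ allNames R → Factorisation noHole R Γ c d
factorise-bot R {c} dR nc = factorisation (bot c R) ⊢bot-R (≈-sym (β-step ⊢cut-R dR bot-one))
  where
  ⊢bot-R = ⊢bot dR (∉allNames⇒∉names dR nc)
  ⊢cut-R = ⊢cut′ ⊢bot-R ⊢one (⊢-Unique dR)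

factorise-ax : ∀ {y A Γ} R {c d} → R ⊢ (y , A) ∷ Γ → y ∉ bound R → c ∉ allNames R →
  Factorisation oneHole R Γ c d
factorise-ax {y} {A} {Γ} R {c} dR y∉ nc =
  factorisation (ren y c R) ⊢R₁ (≈-sym (β-step ⊢cut-R ⊢R (ax-r₂ y∉R₁) ▸ ≈-reflexive (ren-inv R nc)))
  where
  c≢y : c ≢ y
  c≢y = ∉∷⁻ʰ (∉allNames⇒∉names dR nc)
  ⊢R₁ = ⊢ren-head dR nc
  ⊢cut-R = ⊢cut′ ⊢R₁ (⊢ax c≢y) (⊢-Unique dR)
  y∉R₁ : y ∉ allNames (ren y c R)
  y∉R₁ = ∉allNames-ren-self R y∉ (≢-sym c≢y)
  ⊢R = subst (λ t → t ⊢ (y , A) ∷ Γ) (sym (ren-inv R nc)) dR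

factorise-par : ∀ {y A x B Γ} R {c d} → R ⊢ (y , A) ∷ (x , B) ∷ Γ → y ∉ bound R → x ∉ bound R →
  c ∉ allNames R → d ∉ allNames R → c ≢ d → Factorisation twoHoles R Γ c d
factorise-par {y} {A} {x} {B} {Γ} R {c} {d} dR y∉ x∉ nc nd c≢d =
  factorisation (par c d R') (⊢par ⊢R') (≈-sym
    (β-step ⊢T₁ ⊢T₂ par-tens ▸
     step ⊢T₂ ⊢T₂' (cutˡ (root (β-root (ax-r₂ x∉R')))) ▸
     ≈-reflexive (cong (λ t → cut A d t (ax A d y)) (ren-inv S ncS)) ▸
     β-step ⊢T₃ ⊢R (ax-r₂ y∉S) ▸
     ≈-reflexive (ren-inv R nd)))
  where
  nc′ = ∉allNames⇒∉names dR nc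
  nd′ = ∉allNames⇒∉names dR nd
  c≢y = ∉∷⁻ʰ nc′
  c≢x = ∉∷⁻ʰ (∉∷⁻ᵗ nc′)
  d≢y = ∉∷⁻ʰ nd′
  S = ren y d R
  ⊢S : S ⊢ (d , A) ∷ (x , B) ∷ Γ
  ⊢S = ⊢ren-head dR nd
  ncS : c ∉ allNames S
  ncS = ∉allNames-ren R nc c≢d
  R' = ren x c S
  ⊢R' : R' ⊢ (d , A) ∷ (c , B) ∷ Γ
  ⊢R' = ⊢ren-second ⊢S ncS
  ⊢T₁ = ⊢cut′ (⊢par ⊢R')
         (⊢tens (⊢ax d≢y) (⊢ax c≢x) (Unique-∷ (∉∷⁺ c≢y (∉∷⁺ c≢x (λ ()))) (Unique-++⁻ˡ (_ ∷ _ ∷ []) (⊢-Unique dR))))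
         (⊢-Unique dR)
  ⊢inner : cut B c R' (ax B c x) ⊢ ((d , A) ∷ Γ) ++ (x , B) ∷ []
  ⊢inner = ⊢cut (⊢-swap ⊢R') (⊢ax c≢x)
    (Unique-names-resp-↭ (solve 3 (λ dA xB Γ → dA ∙ xB ∙ Γ ⊜ dA ∙ Γ ∙ xB) ↭-refl [ (d , A) ] [ (x , B) ] Γ) (⊢-Unique ⊢S))
  ⊢T₂ : cut A d (cut B c R' (ax B c x)) (ax A d y) ⊢ (y , A) ∷ (x , B) ∷ Γ
  ⊢T₂ = ⊢ex (solve 3 (λ Γ xB yA → (Γ ∙ xB) ∙ yA ⊜ yA ∙ xB ∙ Γ) ↭-refl Γ [ (x , B) ] [ (y , A) ])
         (⊢cut ⊢inner (⊢ax d≢y)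
           (Unique-names-resp-↭ (solve 3 (λ yA xB Γ → yA ∙ xB ∙ Γ ⊜ (Γ ∙ xB) ∙ yA) ↭-refl [ (y , A) ] [ (x , B) ] Γ) (⊢-Unique dR)))
  ⊢T₃ : cut A d S (ax A d y) ⊢ (y , A) ∷ (x , B) ∷ Γ
  ⊢T₃ = ⊢ex (solve 3 (λ xB Γ yA → (xB ∙ Γ) ∙ yA ⊜ yA ∙ xB ∙ Γ) ↭-refl [ (x , B) ] Γ [ (y , A) ])
         (⊢cut ⊢S (⊢ax d≢y)
           (Unique-names-resp-↭ (solve 3 (λ yA xB Γ → yA ∙ xB ∙ Γ ⊜ (xB ∙ Γ) ∙ yA) ↭-refl [ (y , A) ] [ (x , B) ] Γ) (⊢-Unique dR)))
  ⊢T₂' = subst (λ t → cut A d t (ax A d y) ⊢ (y , A) ∷ (x , B) ∷ Γ) (sym (ren-inv S ncS)) ⊢T₃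
  x∉R' : x ∉ allNames R'
  x∉R' = ∉allNames-ren-self S (subst (x ∉_) (sym (bound-ren R)) x∉) (≢-sym c≢x)
  y∉S : y ∉ allNames S
  y∉S = ∉allNames-ren-self R y∉ (≢-sym d≢y)
  ⊢R = subst (λ t → t ⊢ (y , A) ∷ (x , B) ∷ Γ) (sym (ren-inv R nd)) dR

factorise : ∀ {I Γ} (s : HoleShape I) R {c d} → R ⊢ I ++ Γ → Avoids (names I) R →
  c ∉ allNames R → d ∉ allNames R → c ≢ d → Factorisation s R Γ c d
factorise noHole R dR av nc nd c≢d = factorise-bot R dR nc
factorise oneHole R dR av nc nd c≢d = factorise-ax R dR (av (here refl)) nc
factorise twoHoles R dR av nc nd c≢d = factorise-par R dR (av (here refl)) (av (there (here refl))) nc nd c≢d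

-- Commutations involving ⊤

-- Both ⊤-rules are reducts of the cut of top a against top b on a fresh c : 1.
comm-top-top : ∀ {a b Γ₁ Γ₂ Δ} → a ≢ b → top a Γ₁ ⊢ Δ → top b Γ₂ ⊢ Δ → top a Γ₁ ≈⟨ Δ ⟩ top b Γ₂
comm-top-top {a} {b} {Γ₁} {Γ₂} {Δ} ab dP dQ with inv-top dP | inv-top dQ
... | uP , qP | uQ , qQ with ∈-resp-↭ (↭-sym qP) (∈-resp-↭ qQ (here refl))
... | here e = ⊥-elim (ab (sym (cong proj₁ e)))
... | there i with ∈-split i
... | Θ , r = ≈-sym (β-step T⊢ dP (c-topˡ (≢-sym ca))) ▸ β-step T⊢ dQ (c-topʳ (≢-sym cb))
  where
  c = fresh (names Δ)
  nc : c ∉ names Δ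
  nc = fresh∉ (names Δ)
  DK : ((a , ⊤ᶠ) ∷ (b , ⊤ᶠ) ∷ Θ) ↭ Δ
  DK = trans (prep _ (↭-sym r)) qP
  uΔ = ⊢-Unique dP
  U'' = Unique-names-resp-↭ (↭-sym DK) uΔ
  nc' : c ∉ names ((a , ⊤ᶠ) ∷ (b , ⊤ᶠ) ∷ Θ)
  nc' = ∉names-resp-↭ DK nc
  ca : c ≢ a
  ca = ∉∷⁻ʰ nc'
  cb : c ≢ b
  cb = ∉∷⁻ʰ (∉∷⁻ᵗ nc')
  L⊢ : top a ((c , 𝟏) ∷ []) ⊢ (c , 𝟏) ∷ (a , ⊤ᶠ) ∷ []
  L⊢ = ⊢top-second ([] ∷ []) (∉∷⁺ ca (λ ()))
  R⊢ : top b ((c , ⊥ᶠ) ∷ Θ) ⊢ (c , ⊥ᶠ) ∷ (b , ⊤ᶠ) ∷ Θ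
  R⊢ = ⊢top-second (Unique-tail U'') (∉∷⁻ᵗ nc')
  T⊢ : cut 𝟏 c (top a ((c , 𝟏) ∷ [])) (top b ((c , ⊥ᶠ) ∷ Θ)) ⊢ Δ
  T⊢ = ⊢ex DK (⊢cut L⊢ R⊢ U'')

-- Both sides are reducts of the cut of a ⊤-rule against the η-expansion of a : A & B.
comm-wth-top : ∀ {a b Γ₁ Γ₂ Γ Δ} → a ≢ b → wth a (top b Γ₁) (top b Γ₂) ⊢ Δ → top b Γ ⊢ Δ →
  wth a (top b Γ₁) (top b Γ₂) ≈⟨ Δ ⟩ top b Γ
comm-wth-top {a} {b} {Γ₁} {Γ₂} {Γ} {Δ} ab dP dQ with inv-wth dP
... | A , B , Γ₀ , d1 , d2 , q with inv-top d1
... | u1 , q1 with ∈-resp-↭ q1 (here refl)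
... | here e = ⊥-elim (ab (sym (cong proj₁ e)))
... | there i with ∈-split i
... | Θ , r =
  ≈-sym (β-step T⊢ T'⊢ (c-wthʳ (≢-sym ca)) ▸ step T'⊢ T''⊢ (wthˡ (root (β-root (c-topˡ (≢-sym cb))))) ▸
      step T''⊢ dP (wthʳ (root (β-root (c-topˡ (≢-sym cb)))))) ▸
  β-step T⊢ dQ (c-topˡ (≢-sym cb))
  where
  c = fresh (names Δ)
  nc : c ∉ names Δ
  nc = fresh∉ (names Δ)
  DK : ((a , A & B) ∷ (b , ⊤ᶠ) ∷ Θ) ↭ Δ
  DK = trans (prep _ (↭-sym r)) q
  uΔ = ⊢-Unique dP
  U0 = Unique-names-resp-↭ (↭-sym DK) uΔ
  nc' : c ∉ names ((a , A & B) ∷ (b , ⊤ᶠ) ∷ Θ)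
  nc' = ∉names-resp-↭ DK nc
  ca : c ≢ a
  ca = ∉∷⁻ʰ nc'
  cb : c ≢ b
  cb = ∉∷⁻ʰ (∉∷⁻ᵗ nc')
  TOP⊢ : top b ((c , A & B) ∷ Θ) ⊢ (c , A & B) ∷ (b , ⊤ᶠ) ∷ Θ
  TOP⊢ = ⊢top-second (Unique-tail U0) (∉∷⁻ᵗ nc')
  E₁⊢ : plus₁ c (dual B) (ax A c a) ⊢ (c , dual A ⊕ dual B) ∷ (a , A) ∷ []
  E₁⊢ = ⊢plus₁ (⊢ax ca)
  E₂⊢ : plus₂ c (dual A) (ax B c a) ⊢ (c , dual A ⊕ dual B) ∷ (a , B) ∷ []
  E₂⊢ = ⊢plus₂ (⊢ax ca)
  W⊢ : wth a (plus₁ c (dual B) (ax A c a)) (plus₂ c (dual A) (ax B c a)) ⊢ (c , dual A ⊕ dual B) ∷ (a , A & B) ∷ []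
  W⊢ = ⊢ex (swap _ _ refl) (⊢wth (⊢ex (swap _ _ refl) E₁⊢) (⊢ex (swap _ _ refl) E₂⊢))
  T⊢ = ⊢ex (trans (solve 3 (λ b⊤ᶠ Θ aA&B → (b⊤ᶠ ∙ Θ) ∙ aA&B ⊜ aA&B ∙ b⊤ᶠ ∙ Θ) ↭-refl [ (b , ⊤ᶠ) ] Θ [ (a , A & B) ]) DK)
           (⊢cut TOP⊢ W⊢ (Unique-names-resp-↭ (solve 3 (λ aA&B b⊤ᶠ Θ → aA&B ∙ b⊤ᶠ ∙ Θ ⊜ (b⊤ᶠ ∙ Θ) ∙ aA&B) ↭-refl [ (a , A & B) ] [ (b , ⊤ᶠ) ] Θ) U0))
  uA = Unique-names-resp-↭ (solve 3 (λ aA b⊤ᶠ Θ → aA ∙ b⊤ᶠ ∙ Θ ⊜ (b⊤ᶠ ∙ Θ) ∙ aA) ↭-refl [ (a , A) ] [ (b , ⊤ᶠ) ] Θ) U0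
  uB = Unique-names-resp-↭ (solve 3 (λ aB b⊤ᶠ Θ → aB ∙ b⊤ᶠ ∙ Θ ⊜ (b⊤ᶠ ∙ Θ) ∙ aB) ↭-refl [ (a , B) ] [ (b , ⊤ᶠ) ] Θ) U0
  C1⊢ = ⊢ex (solve 3 (λ b⊤ᶠ Θ aA → (b⊤ᶠ ∙ Θ) ∙ aA ⊜ aA ∙ b⊤ᶠ ∙ Θ) ↭-refl [ (b , ⊤ᶠ) ] Θ [ (a , A) ]) (⊢cut TOP⊢ E₁⊢ uA)
  C2⊢ = ⊢ex (solve 3 (λ b⊤ᶠ Θ aB → (b⊤ᶠ ∙ Θ) ∙ aB ⊜ aB ∙ b⊤ᶠ ∙ Θ) ↭-refl [ (b , ⊤ᶠ) ] Θ [ (a , B) ]) (⊢cut TOP⊢ E₂⊢ uB)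
  T'⊢ = ⊢ex DK (⊢wth C1⊢ C2⊢)
  T''⊢ = ⊢ex DK (⊢wth (⊢ex (prep _ r) d1) C2⊢)

-- Both sides are reducts of the cut of a ⊤-rule against H applied to the η-identity
-- on its active formulas.
comm-lin-top : ∀ H {b Γ₀ Γ' Δ} → b ∉ principal H ∷ active H → plug H (top b Γ₀) ⊢ Δ → top b Γ' ⊢ Δ →
  plug H (top b Γ₀) ≈⟨ Δ ⟩ top b Γ'
comm-lin-top H {b} {Γ₀} {Γ'} {Δ} bn dP dQ with plug-inv H dP
... | I , O , Γ₁ , ft , dT , qH with inv-top dT
... | uT , qT with ↭-extract ((b , ⊤ᶠ) ∷ []) Γ₀ I Γ₁ uT
                      (λ {z} k e → ∉∷⁻ᵗ bn (subst (λ L → b ∈ L) (hole-names ft) (subst (_∈ names I) (∈single e) k))) qT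
  where
  ∈single : ∀ {z} → z ∈ names ((b , ⊤ᶠ) ∷ []) → z ≡ b
  ∈single (here e) = e
... | Θ , r1 , r2 =
  ≈-sym (β-step T⊢ M⊢ (cut-plugʳ H cc) ▸ step M⊢ dP (Cong-plug H (root (β-root (c-topˡ (≢-sym cb)))))) ▸ β-step T⊢ dQ (c-topˡ (≢-sym cb))
  where
  S0 = names Δ ++ frameNames H
  c = fresh S0
  d = fresh (c ∷ S0)
  nc : c ∉ S0
  nc = fresh∉ S0
  nd : d ∉ c ∷ S0
  nd = fresh∉ (c ∷ S0)
  DK : (O ++ (b , ⊤ᶠ) ∷ Θ) ↭ Δ
  DK = trans (++⁺ˡ O (↭-sym r2)) qH
  uΔ = ⊢-Unique dP
  U0 = Unique-names-resp-↭ (↭-sym DK) uΔ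
  ncΔ : c ∉ names (O ++ (b , ⊤ᶠ) ∷ Θ)
  ncΔ = ∉names-resp-↭ DK (∉++⁻ˡ (names Δ) nc)
  cb : c ≢ b
  cb = ∉∷⁻ʰ (∉names-++⁻ʳ O ncΔ)
  uIΘ : Unique (names (I ++ Θ))
  uIΘ = Unique-names-resp-↭ r1 (Unique-tail uT)
  s = holeShape ft
  X = packedFormula s
  E = η-identity s c d
  ncF : ∀ {z} → z ∈ frameNames H → c ≢ z
  ncF k = ∉⇒≢ (∉++⁻ʳ (names Δ) nc) k
  ndF : ∀ {z} → z ∈ frameNames H → d ≢ z
  ndF k = ∉⇒≢ (∉++⁻ʳ (names Δ) (∉∷⁻ᵗ nd)) k
  inI : ∀ {z} → z ∈ names I → z ∈ frameNames H
  inI k = active∈frameNames H (subst (_ ∈_) (hole-names ft) k)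
  E⊢ : E ⊢ (c , dual X) ∷ I
  E⊢ = ⊢η-identity s (Unique-names-++⁻ˡ I uIΘ) (λ k → ncF (inI k) refl) (∉∷⁺ (∉∷⁻ʰ nd) (λ k → ndF (inI k) refl))
  ncO : c ∉ names O
  ncO = ∉names-++⁻ˡ O ncΔ
  HE⊢ : plug H E ⊢ (c , dual X) ∷ O
  HE⊢ = ⊢plug-head ft E⊢ (Unique-∷ ncO (Unique-names-++⁻ˡ O U0))
  TOP⊢ : top b ((c , X) ∷ Θ) ⊢ (c , X) ∷ (b , ⊤ᶠ) ∷ Θ
  TOP⊢ = ⊢top-second (Unique-names-++⁻ʳ O U0) (∉names-++⁻ʳ O ncΔ)
  T⊢ : cut X c (top b ((c , X) ∷ Θ)) (plug H E) ⊢ Δ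
  T⊢ = ⊢ex (trans (solve 3 (λ b⊤ᶠ Θ O → (b⊤ᶠ ∙ Θ) ∙ O ⊜ O ∙ b⊤ᶠ ∙ Θ) ↭-refl [ (b , ⊤ᶠ) ] Θ O) DK)
           (⊢cut TOP⊢ HE⊢ (Unique-names-resp-↭ (solve 3 (λ O b⊤ᶠ Θ → O ∙ b⊤ᶠ ∙ Θ ⊜ (b⊤ᶠ ∙ Θ) ∙ O) ↭-refl O [ (b , ⊤ᶠ) ] Θ) U0))
  uC : Unique (names (((b , ⊤ᶠ) ∷ Θ) ++ I))
  uC = Unique-names-resp-↭ (solve 3 (λ I b⊤ᶠ Θ → I ∙ b⊤ᶠ ∙ Θ ⊜ (b⊤ᶠ ∙ Θ) ∙ I) ↭-refl I [ (b , ⊤ᶠ) ] Θ) (Unique-names-resp-↭ (++⁺ˡ I r2) (⊢-Unique dT))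
  M⊢ : plug H (cut X c (top b ((c , X) ∷ Θ)) E) ⊢ Δ
  M⊢ = ⊢ex DK (⊢plug ft (⊢ex (solve 3 (λ b⊤ᶠ Θ I → (b⊤ᶠ ∙ Θ) ∙ I ⊜ I ∙ b⊤ᶠ ∙ Θ) ↭-refl [ (b , ⊤ᶠ) ] Θ I) (⊢cut TOP⊢ E⊢ uC)) U0)
  cc : CutCommutes H c E (top b ((c , X) ∷ Θ))
  cc = mkCC (λ e → ncF (principal∈frameNames H) (sym e))
            (λ k → ncF (binder∈frameNames H k) refl)
            (names⊆fv E⊢ (here refl))
            (λ {b'} k → ∉names⇒∉fv TOP⊢ (∉∷⁺ (λ e → ncF (binder∈frameNames H k) (sym e))
                 (∉∷⁺ (λ e → bn (there (subst (_∈ active H) e (binder∈active H k))))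
                     (Unique-names-disjoint I uIΘ (subst (b' ∈_) (sym (hole-names ft)) (binder∈active H k))))))
            (∉names⇒∉fv TOP⊢ (∉∷⁺ (λ e → ncF (principal∈frameNames H) (sym e)) (Unique-names-disjoint O U0 (principal∈conclusion ft))))

-- Two linear rules

module LinLin (F G : Frame) {R : Term} {Δ : Sequent}
  (h1 : principal G ∉ active F) (h2 : principal F ∉ active G) (h3 : principal F ≢ principal G)
  (h4 : Disjoint (binders F) (frameNames G)) (h5 : Disjoint (binders G) (frameNames F)) (cR : CutFree R)
  (dP : plug F (plug G R) ⊢ Δ)
  {I_F O_F Γ₁ : Sequent} (ftF : FrameTyping F I_F O_F) (dGR : plug G R ⊢ I_F ++ Γ₁) (qF : (O_F ++ Γ₁) ↭ Δ)
  {I_G O_G Γ₂ : Sequent} (ftG : FrameTyping G I_G O_G) (dR : R ⊢ I_G ++ Γ₂) (qG : (O_G ++ Γ₂) ↭ (I_F ++ Γ₁))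
  (Θ : Sequent) (r1 : Γ₂ ↭ I_F ++ Θ) (r2 : Γ₁ ↭ O_G ++ Θ) where

  uΔ = ⊢-Unique dP
  DK : (O_F ++ O_G ++ Θ) ↭ Δ
  DK = trans (++⁺ˡ O_F (↭-sym r2)) qF
  UD : Unique (names (O_F ++ O_G ++ Θ))
  UD = Unique-names-resp-↭ (↭-sym DK) uΔ
  UR : Unique (names (I_G ++ Γ₂))
  UR = ⊢-Unique dR

  Nm = freshen (names I_G) R cR dR
  open Freshened Nm

  S0 = allNames R̃ ++ names Δ ++ frameNames F ++ frameNames G
  c = fresh S0
  d = fresh (c ∷ S0)
  nc : c ∉ S0
  nc = fresh∉ S0
  nd : d ∉ c ∷ S0
  nd = fresh∉ (c ∷ S0)
  ncR : c ∉ allNames R̃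
  ncR = ∉++⁻ˡ (allNames R̃) nc
  ndR : d ∉ allNames R̃
  ndR = ∉++⁻ˡ (allNames R̃) (∉∷⁻ᵗ nd)
  ncΔ : c ∉ names (O_F ++ O_G ++ Θ)
  ncΔ = ∉names-resp-↭ DK (∉++⁻ˡ (names Δ) (∉++⁻ʳ (allNames R̃) nc))
  ncF : ∀ {z} → z ∈ frameNames F → c ≢ z
  ncF k = ∉⇒≢ (∉++⁻ˡ (frameNames F) (∉++⁻ʳ (names Δ) (∉++⁻ʳ (allNames R̃) nc))) k
  ncG : ∀ {z} → z ∈ frameNames G → c ≢ z
  ncG k = ∉⇒≢ (∉++⁻ʳ (frameNames F) (∉++⁻ʳ (names Δ) (∉++⁻ʳ (allNames R̃) nc))) k
  ndG : ∀ {z} → z ∈ frameNames G → d ≢ z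
  ndG k = ∉⇒≢ (∉++⁻ʳ (frameNames F) (∉++⁻ʳ (names Δ) (∉++⁻ʳ (allNames R̃) (∉∷⁻ᵗ nd)))) k

  s = holeShape ftG
  X = packedFormula s
  E = η-identity s c d
  Dc = factorise s R̃ {c} {d} ⊢R̃ R̃-avoids ncR ndR (λ e → ∉∷⁻ʰ nd (sym e))
  open Factorisation Dc

  inIG : ∀ {z} → z ∈ names I_G → z ∈ frameNames G
  inIG k = active∈frameNames G (hole∈active ftG k)

  E⊢ : E ⊢ (c , dual X) ∷ I_G
  E⊢ = ⊢η-identity s (Unique-names-++⁻ˡ I_G UR) (λ k → ncG (inIG k) refl) (∉∷⁺ (∉∷⁻ʰ nd) (λ k → ndG (inIG k) refl))

  UGR : Unique (names (I_F ++ Γ₁))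
  UGR = ⊢-Unique dGR
  U-OGΓ₂ : Unique (names (O_G ++ Γ₂))
  U-OGΓ₂ = Unique-names-resp-↭ (↭-sym qG) UGR
  UR' : Unique (names (I_G ++ I_F ++ Θ))
  UR' = Unique-names-resp-↭ (++⁺ˡ I_G r1) UR
  U-IGΘ : Unique (names (I_G ++ Θ))
  U-IGΘ = Unique-names-++⁻ʳ I_F (Unique-names-resp-↭ (solve 3 (λ I_G I_F Θ → I_G ∙ I_F ∙ Θ ⊜ I_F ∙ I_G ∙ Θ) ↭-refl I_G I_F Θ) UR')
  U-OFΘ : Unique (names (O_F ++ Θ))
  U-OFΘ = Unique-names-++⁻ʳ O_G (Unique-names-resp-↭ (solve 3 (λ O_F O_G Θ → O_F ∙ O_G ∙ Θ ⊜ O_G ∙ O_F ∙ Θ) ↭-refl O_F O_G Θ) UD)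
  U-OG : Unique (names O_G)
  U-OG = Unique-names-++⁻ˡ O_G (Unique-names-++⁻ʳ O_F UD)
  U-OGOFΘ : Unique (names (O_G ++ O_F ++ Θ))
  U-OGOFΘ = Unique-names-resp-↭ (solve 3 (λ O_F O_G Θ → O_F ∙ O_G ∙ Θ ⊜ O_G ∙ O_F ∙ Θ) ↭-refl O_F O_G Θ) UD
  IG∩OF : ∀ {z} → z ∈ names I_G → z ∉ names O_F
  IG∩OF k with active-split G (hole∈active ftG k)
  ... | inj₁ refl = ∉names-++⁻ˡ O_F (Unique-names-disjoint O_G U-OGOFΘ (principal∈conclusion ftG))
  ... | inj₂ b = λ k' → h5 (b , conclusion⊆frameNames ftF k')
  OF∩IGΘ : ∀ {z} → z ∈ names O_F → z ∉ names (I_G ++ Θ)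
  OF∩IGΘ k k' with names-++⁻ I_G k'
  ... | inj₁ j = IG∩OF j k
  ... | inj₂ j = Unique-names-disjoint O_F U-OFΘ k j
  U-OF-IGΘ : Unique (names (O_F ++ I_G ++ Θ))
  U-OF-IGΘ = Unique-names-++⁺ O_F (I_G ++ Θ) (Unique-names-++⁻ˡ O_F UD) U-IGΘ OF∩IGΘ
  U-IG-OFΘ : Unique (names (I_G ++ O_F ++ Θ))
  U-IG-OFΘ = Unique-names-resp-↭ (solve 3 (λ O_F I_G Θ → O_F ∙ I_G ∙ Θ ⊜ I_G ∙ O_F ∙ Θ) ↭-refl O_F I_G Θ) U-OF-IGΘ
  ncOG : c ∉ names O_G
  ncOG = ∉names-++⁻ˡ O_G (∉names-++⁻ʳ O_F ncΔ)
  ncOFΘ : c ∉ names (O_F ++ Θ)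
  ncOFΘ = ∉names-++⁻ʳ O_G (∉names-resp-↭ (solve 3 (λ O_G O_F Θ → O_G ∙ O_F ∙ Θ ⊜ O_F ∙ O_G ∙ Θ) ↭-refl O_G O_F Θ) ncΔ)

  tP : ∀ {t} → t ⊢ I_G ++ Γ₂ → plug F (plug G t) ⊢ Δ
  tP e = ⊢ex qF (⊢plug ftF (⊢ex qG (⊢plug ftG e U-OGΓ₂)) (Unique-names-resp-↭ (↭-sym qF) uΔ))
  tQ : ∀ {t} → t ⊢ I_G ++ Γ₂ → plug G (plug F t) ⊢ Δ
  tQ e = ⊢ex (trans (solve 3 (λ O_G O_F Θ → O_G ∙ O_F ∙ Θ ⊜ O_F ∙ O_G ∙ Θ) ↭-refl O_G O_F Θ) DK)
           (⊢plug ftG (⊢ex (solve 3 (λ O_F I_G Θ → O_F ∙ I_G ∙ Θ ⊜ I_G ∙ O_F ∙ Θ) ↭-refl O_F I_G Θ)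
                           (⊢plug ftF (⊢ex (trans (++⁺ˡ I_G r1) (solve 3 (λ I_G I_F Θ → I_G ∙ I_F ∙ Θ ⊜ I_F ∙ I_G ∙ Θ) ↭-refl I_G I_F Θ)) e) U-OF-IGΘ))
              U-OGOFΘ)
  chP : plug F (plug G R) ≈⟨ Δ ⟩ plug F (plug G (cut X c R₁ E))
  chP = ≈-cong (λ t → plug F (plug G t)) (λ s → Cong-plug F (Cong-plug G s)) tP (R≈R̃ ▸ R≈cut)
  chQ : plug G (plug F R) ≈⟨ Δ ⟩ plug G (plug F (cut X c R₁ E))
  chQ = ≈-cong (λ t → plug G (plug F t)) (λ s → Cong-plug G (Cong-plug F s)) tQ (R≈R̃ ▸ R≈cut)

  cutRE⊢ : cut X c R₁ E ⊢ I_G ++ Γ₂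
  cutRE⊢ = ⊢cut′ ⊢R₁ E⊢ UR
  GE⊢ : plug G E ⊢ (c , dual X) ∷ O_G
  GE⊢ = ⊢plug-head ftG E⊢ (Unique-∷ ncOG U-OG)
  FR₁⊢ : plug F R₁ ⊢ (c , X) ∷ O_F ++ Θ
  FR₁⊢ = ⊢ex (solve 3 (λ O_F cX Θ → O_F ∙ cX ∙ Θ ⊜ cX ∙ O_F ∙ Θ) ↭-refl O_F [ (c , X) ] Θ)
           (⊢plug ftF (⊢ex (trans (prep _ r1) (solve 3 (λ cX I_F Θ → cX ∙ I_F ∙ Θ ⊜ I_F ∙ cX ∙ Θ) ↭-refl [ (c , X) ] I_F Θ)) ⊢R₁)
              (Unique-names-resp-↭ (solve 3 (λ cX O_F Θ → cX ∙ O_F ∙ Θ ⊜ O_F ∙ cX ∙ Θ) ↭-refl [ (c , X) ] O_F Θ) (Unique-∷ ncOFΘ U-OFΘ)))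
  M1⊢ : plug F (cut X c R₁ (plug G E)) ⊢ Δ
  M1⊢ = ⊢ex DK (⊢plug ftF (⊢ex (trans (++⁺ˡ O_G r1) (solve 3 (λ O_G I_F Θ → O_G ∙ I_F ∙ Θ ⊜ I_F ∙ O_G ∙ Θ) ↭-refl O_G I_F Θ)) (⊢cut′ ⊢R₁ GE⊢ U-OGΓ₂)) UD)
  M2⊢ : cut X c (plug F R₁) (plug G E) ⊢ Δ
  M2⊢ = ⊢ex (trans (solve 3 (λ O_G O_F Θ → O_G ∙ O_F ∙ Θ ⊜ O_F ∙ O_G ∙ Θ) ↭-refl O_G O_F Θ) DK) (⊢cut′ FR₁⊢ GE⊢ U-OGOFΘ)
  M3⊢ : plug G (cut X c (plug F R₁) E) ⊢ Δ
  M3⊢ = ⊢ex (trans (solve 3 (λ O_G O_F Θ → O_G ∙ O_F ∙ Θ ⊜ O_F ∙ O_G ∙ Θ) ↭-refl O_G O_F Θ) DK) (⊢plug ftG (⊢cut′ FR₁⊢ E⊢ U-IG-OFΘ) U-OGOFΘ)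

  cc1 : CutCommutes G c E R₁
  cc1 = mkCC (λ e → ncG (principal∈frameNames G) (sym e)) (λ k → ncG (binder∈frameNames G k) refl) (names⊆fv E⊢ (here refl))
          (λ k → ∉names⇒∉fv ⊢R₁ (∉∷⁺ (λ e → ncG (binder∈frameNames G k) (sym e)) (Unique-names-disjoint I_G UR (binder∈hole ftG k))))
          (∉names⇒∉fv ⊢R₁ (∉∷⁺ (λ e → ncG (principal∈frameNames G) (sym e)) (Unique-names-disjoint O_G U-OGΓ₂ (principal∈conclusion ftG))))
  cc2 : CutCommutes F c R₁ (plug G E)
  cc2 = mkCC (λ e → ncF (principal∈frameNames F) (sym e)) (λ k → ncF (binder∈frameNames F k) refl) (names⊆fv ⊢R₁ (here refl))
          (λ {b} k → ∉names⇒∉fv GE⊢ (∉∷⁺ (λ e → ncF (binder∈frameNames F k) (sym e)) (λ k' → h4 (k , conclusion⊆frameNames ftG k'))))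
          (∉names⇒∉fv GE⊢ (∉∷⁺ (λ e → ncF (principal∈frameNames F) (sym e)) (∉names-++⁻ˡ O_G (Unique-names-disjoint O_F UD (principal∈conclusion ftF)))))
  cc3 : CutCommutes G c E (plug F R₁)
  cc3 = mkCC (λ e → ncG (principal∈frameNames G) (sym e)) (λ k → ncG (binder∈frameNames G k) refl) (names⊆fv E⊢ (here refl))
          (λ k → ∉names⇒∉fv FR₁⊢ (∉∷⁺ (λ e → ncG (binder∈frameNames G k) (sym e))
                   (∉names-++⁺ O_F (λ k' → h5 (k , conclusion⊆frameNames ftF k')) (Unique-names-disjoint I_G U-IGΘ (binder∈hole ftG k)))))
          (∉names⇒∉fv FR₁⊢ (∉∷⁺ (λ e → ncG (principal∈frameNames G) (sym e)) (Unique-names-disjoint O_G U-OGOFΘ (principal∈conclusion ftG))))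
  cc4 : CutCommutes F c R₁ E
  cc4 = mkCC (λ e → ncF (principal∈frameNames F) (sym e)) (λ k → ncF (binder∈frameNames F k) refl) (names⊆fv ⊢R₁ (here refl))
          (λ k → ∉names⇒∉fv E⊢ (∉∷⁺ (λ e → ncF (binder∈frameNames F k) (sym e)) (λ k' → h4 (k , inIG k'))))
          (∉names⇒∉fv E⊢ (∉∷⁺ (λ e → ncF (principal∈frameNames F) (sym e)) (λ k' → h2 (hole∈active ftG k'))))

  result : plug F (plug G R) ≈⟨ Δ ⟩ plug G (plug F R)
  -- With R ≈ cut R₁ E, both orders are reached from cut (F R₁) (G E) by commuting
  -- the cut with F and with G:
  -- F (G (cut R₁ E)) ← F (cut R₁ (G E)) ← cut (F R₁) (G E) → G (cut (F R₁) E) → G (F (cut R₁ E)).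
  result = chP ▸ ≈-sym (step M1⊢ (tP cutRE⊢) (Cong-plug F (root (β-root (cut-plugʳ G cc1))))) ▸
           ≈-sym (β-step M2⊢ M1⊢ (cut-plugˡ F cc2)) ▸ β-step M2⊢ M3⊢ (cut-plugʳ G cc3) ▸
           step M3⊢ (tQ cutRE⊢) (Cong-plug G (root (β-root (cut-plugˡ F cc4)))) ▸ ≈-sym chQ

comm-lin-lin : ∀ F G {R Δ} → principal G ∉ active F → principal F ∉ active G → principal F ≢ principal G →
  Disjoint (binders F) (frameNames G) → Disjoint (binders G) (frameNames F) → CutFree R →
  plug F (plug G R) ⊢ Δ → plug G (plug F R) ⊢ Δ → plug F (plug G R) ≈⟨ Δ ⟩ plug G (plug F R)
comm-lin-lin F G {R} {Δ} h1 h2 h3 h4 h5 cR dP dQ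
  with plug-inv F dP
... | I_F , O_F , Γ₁ , ftF , dGR , qF with plug-inv G dGR
... | I_G , O_G , Γ₂ , ftG , dR , qG with plug-inv G dQ
... | I_G' , O_G' , Γ₂' , ftG' , dFR , qG' with plug-inv F dFR
... | I_F'' , O_F'' , Γ₃ , ftF'' , dR'' , qF'' = go (↭-extract O_G Γ₂ I_F Γ₁ (Unique-names-resp-↭ (↭-sym qG) (⊢-Unique dGR)) djIO qG)
  where
  uΔ = ⊢-Unique dP
  pF∉OG : principal F ∉ names O_G
  pF∉OG k with names-++⁻ I_G' (∈-resp-↭ (names-↭ qF'') (names-++⁺ˡ Γ₃ (principal∈conclusion ftF'')))
  ... | inj₁ j = h2 (hole∈active ftG' j)
  ... | inj₂ j = Unique-names-disjoint O_G' (Unique-names-resp-↭ (↭-sym qG') uΔ) (∈-resp-↭ (FrameTyping-names ftG ftG') k) j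
  djIO : ∀ {z} → z ∈ names I_F → z ∉ names O_G
  djIO {z} k with active-split F (hole∈active ftF k)
  ... | inj₁ refl = pF∉OG
  ... | inj₂ b = λ k' → h4 (b , conclusion⊆frameNames ftG k')
  go : (Σ Sequent λ Θ → (Γ₂ ↭ I_F ++ Θ) × (Γ₁ ↭ O_G ++ Θ)) → plug F (plug G R) ≈⟨ Δ ⟩ plug G (plug F R)
  go (Θ , r1 , r2) = LinLin.result F G h1 h2 h3 h4 h5 cR dP ftF dGR qF ftG dR qG Θ r1 r2

-- A linear rule and a &-rule

module LinWth (H : Frame) {b : Name} {R₁ R₂ : Term} {Δ : Sequent}
  (hb1 : b ∉ principal H ∷ active H) (hb2 : b ∉ binders H) (cR₁ : CutFree R₁) (cR₂ : CutFree R₂)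
  (dP : plug H (wth b R₁ R₂) ⊢ Δ)
  {I O Γ₁ : Sequent} (ft : FrameTyping H I O) (dW : wth b R₁ R₂ ⊢ I ++ Γ₁) (qH : (O ++ Γ₁) ↭ Δ)
  {C D : Formula} {Γw : Sequent} (d1 : R₁ ⊢ (b , C) ∷ Γw) (d2 : R₂ ⊢ (b , D) ∷ Γw)
  (qw : ((b , C & D) ∷ Γw) ↭ (I ++ Γ₁))
  (Θ : Sequent) (r1 : Γw ↭ I ++ Θ) (r2 : Γ₁ ↭ (b , C & D) ∷ Θ) where

  uΔ = ⊢-Unique dP
  DK : (O ++ (b , C & D) ∷ Θ) ↭ Δ
  DK = trans (++⁺ˡ O (↭-sym r2)) qH
  UD : Unique (names (O ++ (b , C & D) ∷ Θ))
  UD = Unique-names-resp-↭ (↭-sym DK) uΔ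
  UW : Unique (names (I ++ (b , C & D) ∷ Θ))
  UW = Unique-names-resp-↭ (++⁺ˡ I r2) (⊢-Unique dW)
  UIΘ : Unique (names (I ++ Θ))
  UIΘ = Unique-names-resp-↭ r1 (Unique-tail (Unique-names-resp-↭ (↭-sym qw) (⊢-Unique dW)))

  UbIΘ : Unique (b ∷ names (I ++ Θ))
  UbIΘ = Unique-names-resp-↭ (solve 3 (λ I bC&D Θ → I ∙ bC&D ∙ Θ ⊜ bC&D ∙ I ∙ Θ) ↭-refl I [ (b , C & D) ] Θ) UW
  UbOΘ : Unique (b ∷ names (O ++ Θ))
  UbOΘ = Unique-names-resp-↭ (solve 3 (λ O bC&D Θ → O ∙ bC&D ∙ Θ ⊜ bC&D ∙ O ∙ Θ) ↭-refl O [ (b , C & D) ] Θ) UD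

  d1' : R₁ ⊢ I ++ (b , C) ∷ Θ
  d1' = ⊢ex (trans (prep _ r1) (solve 3 (λ bC I Θ → bC ∙ I ∙ Θ ⊜ I ∙ bC ∙ Θ) ↭-refl [ (b , C) ] I Θ)) d1
  d2' : R₂ ⊢ I ++ (b , D) ∷ Θ
  d2' = ⊢ex (trans (prep _ r1) (solve 3 (λ bD I Θ → bD ∙ I ∙ Θ ⊜ I ∙ bD ∙ Θ) ↭-refl [ (b , D) ] I Θ)) d2

  N1 = freshen (names I) R₁ cR₁ d1'
  N2 = freshen (names I) R₂ cR₂ d2'
  R̃₁ = Freshened.R̃ N1
  R̃₂ = Freshened.R̃ N2

  S0 = allNames R̃₁ ++ allNames R̃₂ ++ names Δ ++ frameNames H
  c = fresh S0
  d = fresh (c ∷ S0)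
  nc : c ∉ S0
  nc = fresh∉ S0
  nd : d ∉ c ∷ S0
  nd = fresh∉ (c ∷ S0)
  nc3 : c ∉ names Δ ++ frameNames H
  nc3 = ∉++⁻ʳ (allNames R̃₂) (∉++⁻ʳ (allNames R̃₁) nc)
  nd3 : d ∉ names Δ ++ frameNames H
  nd3 = ∉++⁻ʳ (allNames R̃₂) (∉++⁻ʳ (allNames R̃₁) (∉∷⁻ᵗ nd))
  ncΔ : c ∉ names (O ++ (b , C & D) ∷ Θ)
  ncΔ = ∉names-resp-↭ DK (∉++⁻ˡ (names Δ) nc3)
  ncH : ∀ {z} → z ∈ frameNames H → c ≢ z
  ncH k = ∉⇒≢ (∉++⁻ʳ (names Δ) nc3) k
  ndH : ∀ {z} → z ∈ frameNames H → d ≢ z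
  ndH k = ∉⇒≢ (∉++⁻ʳ (names Δ) nd3) k
  b≢c : b ≢ c
  b≢c e = ∉∷⁻ʰ (∉names-++⁻ʳ O ncΔ) (sym e)
  cd : c ≢ d
  cd e = ∉∷⁻ʰ nd (sym e)

  s = holeShape ft
  X = packedFormula s
  E = η-identity s c d
  inI : ∀ {z} → z ∈ names I → z ∈ frameNames H
  inI k = active∈frameNames H (hole∈active ft k)
  E⊢ : E ⊢ (c , dual X) ∷ I
  E⊢ = ⊢η-identity s (Unique-names-++⁻ˡ I UIΘ) (λ k → ncH (inI k) refl) (∉∷⁺ (∉∷⁻ʰ nd) (λ k → ndH (inI k) refl))

  Dc1 = factorise s R̃₁ {c} {d} (Freshened.⊢R̃ N1) (Freshened.R̃-avoids N1) (∉++⁻ˡ (allNames R̃₁) nc) (∉++⁻ˡ (allNames R̃₁) (∉∷⁻ᵗ nd)) cd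
  Dc2 = factorise s R̃₂ {c} {d} (Freshened.⊢R̃ N2) (Freshened.R̃-avoids N2)
          (∉++⁻ˡ (allNames R̃₂) (∉++⁻ʳ (allNames R̃₁) nc)) (∉++⁻ˡ (allNames R̃₂) (∉++⁻ʳ (allNames R̃₁) (∉∷⁻ᵗ nd))) cd
  A₁ = Factorisation.R₁ Dc1
  A₂ = Factorisation.R₁ Dc2
  ⊢A₁ : A₁ ⊢ (c , X) ∷ (b , C) ∷ Θ
  ⊢A₁ = Factorisation.⊢R₁ Dc1
  ⊢A₂ : A₂ ⊢ (c , X) ∷ (b , D) ∷ Θ
  ⊢A₂ = Factorisation.⊢R₁ Dc2
  ch1 : R₁ ≈⟨ I ++ (b , C) ∷ Θ ⟩ cut X c A₁ E
  ch1 = Freshened.R≈R̃ N1 ▸ Factorisation.R≈cut Dc1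
  ch2 : R₂ ≈⟨ I ++ (b , D) ∷ Θ ⟩ cut X c A₂ E
  ch2 = Freshened.R≈R̃ N2 ▸ Factorisation.R≈cut Dc2

  HE⊢ : plug H E ⊢ (c , dual X) ∷ O
  HE⊢ = ⊢plug-head ft E⊢ (Unique-∷ (∉names-++⁻ˡ O ncΔ) (Unique-names-++⁻ˡ O UD))

  tl : ∀ {t} {Z} → t ⊢ I ++ (b , Z) ∷ Θ → t ⊢ (b , Z) ∷ I ++ Θ
  tl {Z = Z} e = ⊢ex (solve 3 (λ I bZ Θ → I ∙ bZ ∙ Θ ⊜ bZ ∙ I ∙ Θ) ↭-refl I [ (b , Z) ] Θ) e
  tlO : ∀ {t} {Z} → t ⊢ O ++ (b , Z) ∷ Θ → t ⊢ (b , Z) ∷ O ++ Θ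
  tlO {Z = Z} e = ⊢ex (solve 3 (λ O bZ Θ → O ∙ bZ ∙ Θ ⊜ bZ ∙ O ∙ Θ) ↭-refl O [ (b , Z) ] Θ) e
  UbI : ∀ {Z} → Unique (names (I ++ (b , Z) ∷ Θ))
  UbI {Z} = Unique-names-resp-↭ (solve 3 (λ bZ I Θ → bZ ∙ I ∙ Θ ⊜ I ∙ bZ ∙ Θ) ↭-refl [ (b , Z) ] I Θ) UbIΘ
  UbO : ∀ {Z} → Unique (names (O ++ (b , Z) ∷ Θ))
  UbO {Z} = Unique-names-resp-↭ (solve 3 (λ bZ O Θ → bZ ∙ O ∙ Θ ⊜ O ∙ bZ ∙ Θ) ↭-refl [ (b , Z) ] O Θ) UbOΘ
  hW : ∀ {t u} → t ⊢ (b , C) ∷ I ++ Θ → u ⊢ (b , D) ∷ I ++ Θ → plug H (wth b t u) ⊢ Δ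
  hW e f = ⊢ex DK (⊢plug ft (⊢ex (solve 3 (λ bC&D I Θ → bC&D ∙ I ∙ Θ ⊜ I ∙ bC&D ∙ Θ) ↭-refl [ (b , C & D) ] I Θ) (⊢wth e f)) UD)
  wH : ∀ {t u} → t ⊢ (b , C) ∷ O ++ Θ → u ⊢ (b , D) ∷ O ++ Θ → wth b t u ⊢ Δ
  wH e f = ⊢ex (trans (solve 3 (λ bC&D O Θ → bC&D ∙ O ∙ Θ ⊜ O ∙ bC&D ∙ Θ) ↭-refl [ (b , C & D) ] O Θ) DK) (⊢wth e f)
  Hp : ∀ {t} {Z} → t ⊢ I ++ (b , Z) ∷ Θ → plug H t ⊢ (b , Z) ∷ O ++ Θ
  Hp e = tlO (⊢plug ft e UbO)

  chP : plug H (wth b R₁ R₂) ≈⟨ Δ ⟩ plug H (wth b (cut X c A₁ E) (cut X c A₂ E))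
  chP = ≈-cong (λ t → plug H (wth b t R₂)) (λ s → Cong-plug H (wthˡ s)) (λ e → hW (tl e) (tl d2')) ch1 ▸
        ≈-cong (λ t → plug H (wth b (cut X c A₁ E) t)) (λ s → Cong-plug H (wthʳ s))
               (λ e → hW (tl (⊢cut′ ⊢A₁ E⊢ UbI)) (tl e)) ch2
  chQ : wth b (plug H R₁) (plug H R₂) ≈⟨ Δ ⟩ wth b (plug H (cut X c A₁ E)) (plug H (cut X c A₂ E))
  chQ = ≈-cong (λ t → wth b (plug H t) (plug H R₂)) (λ s → wthˡ (Cong-plug H s)) (λ e → wH (Hp e) (Hp d2')) ch1 ▸
        ≈-cong (λ t → wth b (plug H (cut X c A₁ E)) (plug H t)) (λ s → wthʳ (Cong-plug H s))
               (λ e → wH (Hp (⊢cut′ ⊢A₁ E⊢ UbI)) (Hp e)) ch2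

  W⊢ : wth b A₁ A₂ ⊢ (c , X) ∷ (b , C & D) ∷ Θ
  W⊢ = ⊢ex (swap _ _ refl) (⊢wth (⊢ex (swap _ _ refl) ⊢A₁) (⊢ex (swap _ _ refl) ⊢A₂))
  T0⊢ : plug H (cut X c (wth b A₁ A₂) E) ⊢ Δ
  T0⊢ = ⊢ex DK (⊢plug ft (⊢cut′ W⊢ E⊢ UW) UD)
  T1⊢ : plug H (wth b (cut X c A₁ E) (cut X c A₂ E)) ⊢ Δ
  T1⊢ = hW (tl (⊢cut′ ⊢A₁ E⊢ UbI)) (tl (⊢cut′ ⊢A₂ E⊢ UbI))
  T2⊢ : cut X c (wth b A₁ A₂) (plug H E) ⊢ Δ
  T2⊢ = ⊢ex DK (⊢cut′ W⊢ HE⊢ UD)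
  T3⊢ : wth b (cut X c A₁ (plug H E)) (cut X c A₂ (plug H E)) ⊢ Δ
  T3⊢ = wH (tlO (⊢cut′ ⊢A₁ HE⊢ UbO)) (tlO (⊢cut′ ⊢A₂ HE⊢ UbO))
  T4⊢ : wth b (plug H (cut X c A₁ E)) (cut X c A₂ (plug H E)) ⊢ Δ
  T4⊢ = wH (Hp (⊢cut′ ⊢A₁ E⊢ UbI)) (tlO (⊢cut′ ⊢A₂ HE⊢ UbO))
  T5⊢ : wth b (plug H (cut X c A₁ E)) (plug H (cut X c A₂ E)) ⊢ Δ
  T5⊢ = wH (Hp (⊢cut′ ⊢A₁ E⊢ UbI)) (Hp (⊢cut′ ⊢A₂ E⊢ UbI))

  pHO : principal H ∉ b ∷ names Θ
  pHO = Unique-names-disjoint O UD (principal∈conclusion ft)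
  bHΘ : ∀ {b'} → b' ∈ binders H → b' ∉ b ∷ names Θ
  bHΘ {b'} k = ∉∷⁺ (λ e → hb2 (subst (_∈ binders H) e k)) (Unique-names-disjoint I UIΘ (binder∈hole ft k))
  ccX : ∀ {Z t} → t ⊢ (c , X) ∷ (b , Z) ∷ Θ → CutCommutes H c E t
  ccX dt = mkCC (λ e → ncH (principal∈frameNames H) (sym e)) (λ k → ncH (binder∈frameNames H k) refl) (names⊆fv E⊢ (here refl))
             (λ k → ∉names⇒∉fv dt (∉∷⁺ (λ e → ncH (binder∈frameNames H k) (sym e)) (bHΘ k)))
             (∉names⇒∉fv dt (∉∷⁺ (λ e → ncH (principal∈frameNames H) (sym e)) pHO))

  result : plug H (wth b R₁ R₂) ≈⟨ Δ ⟩ wth b (plug H R₁) (plug H R₂)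
  -- With Rᵢ ≈ cut Aᵢ E, the left side is reached from cut (wth b A₁ A₂) (H E) by
  -- commuting the cut with H, the right side by commuting it into the &-rule,
  -- which duplicates H E.
  result = chP ▸ ≈-sym (step T0⊢ T1⊢ (Cong-plug H (root (β-root (c-wthˡ b≢c))))) ▸
           ≈-sym (β-step T2⊢ T0⊢ (cut-plugʳ H (ccX W⊢))) ▸ β-step T2⊢ T3⊢ (c-wthˡ b≢c) ▸
           step T3⊢ T4⊢ (wthˡ (root (β-root (cut-plugʳ H (ccX ⊢A₁))))) ▸
           step T4⊢ T5⊢ (wthʳ (root (β-root (cut-plugʳ H (ccX ⊢A₂))))) ▸ ≈-sym chQ

comm-lin-wth : ∀ H {b R₁ R₂ Δ} → b ∉ principal H ∷ active H → b ∉ binders H → CutFree (plug H (wth b R₁ R₂)) →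
  plug H (wth b R₁ R₂) ⊢ Δ → plug H (wth b R₁ R₂) ≈⟨ Δ ⟩ wth b (plug H R₁) (plug H R₂)
comm-lin-wth H {b} hb1 hb2 cP dP with plug-inv H dP
... | I , O , Γ₁ , ft , dW , qH with inv-wth dW
... | C , D , Γw , d1 , d2 , qw with ↭-extract ((b , C & D) ∷ []) Γw I Γ₁ (Unique-names-resp-↭ (↭-sym qw) (⊢-Unique dW))
                                    (λ {z} k e → ∉∷⁻ᵗ hb1 (hole∈active ft (subst (_∈ names I) (one∈ e) k))) qw
  where
  one∈ : ∀ {z} → z ∈ names ((b , C & D) ∷ []) → z ≡ b
  one∈ (here e) = e
... | Θ , r1 , r2 = LinWth.result H hb1 hb2 (proj₁ (CutFree-plug⁻ H cP)) (proj₂ (CutFree-plug⁻ H cP)) dP ft dW qH d1 d2 qw Θ r1 r2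

-- Two &-rules

module WthWth {a b : Name} {A B C D : Formula} {Θ Δ : Sequent} (hab : a ≢ b)
  {R₁ R₂ R₃ R₄ : Term} (c₁ : CutFree R₁) (c₂ : CutFree R₂) (c₃ : CutFree R₃) (c₄ : CutFree R₄)
  (d1 : R₁ ⊢ (b , C) ∷ (a , A) ∷ Θ) (d2 : R₂ ⊢ (b , D) ∷ (a , A) ∷ Θ)
  (d3 : R₃ ⊢ (b , C) ∷ (a , B) ∷ Θ) (d4 : R₄ ⊢ (b , D) ∷ (a , B) ∷ Θ)
  (DK : ((a , A & B) ∷ (b , C & D) ∷ Θ) ↭ Δ) (uΔ : Unique (names Δ)) where

  DK' : ((b , C & D) ∷ (a , A & B) ∷ Θ) ↭ Δ
  DK' = trans (swap _ _ refl) DK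
  UbaΘ : Unique (b ∷ a ∷ names Θ)
  UbaΘ = Unique-names-resp-↭ (↭-sym DK') uΔ

  N1 = freshen (b ∷ []) R₁ c₁ d1
  N2 = freshen (b ∷ []) R₂ c₂ d2
  N3 = freshen (b ∷ []) R₃ c₃ d3
  N4 = freshen (b ∷ []) R₄ c₄ d4
  S₁ = Freshened.R̃ N1
  S₂ = Freshened.R̃ N2
  S₃ = Freshened.R̃ N3
  S₄ = Freshened.R̃ N4
  S0 = allNames S₁ ++ allNames S₂ ++ allNames S₃ ++ allNames S₄ ++ names Δ
  c = fresh S0
  nc : c ∉ S0
  nc = fresh∉ S0
  nc1 : c ∉ allNames S₁
  nc1 = ∉++⁻ˡ (allNames S₁) nc
  nc2 : c ∉ allNames S₂
  nc2 = ∉++⁻ˡ (allNames S₂) (∉++⁻ʳ (allNames S₁) nc)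
  nc3 : c ∉ allNames S₃
  nc3 = ∉++⁻ˡ (allNames S₃) (∉++⁻ʳ (allNames S₂) (∉++⁻ʳ (allNames S₁) nc))
  nc4 : c ∉ allNames S₄
  nc4 = ∉++⁻ˡ (allNames S₄) (∉++⁻ʳ (allNames S₃) (∉++⁻ʳ (allNames S₂) (∉++⁻ʳ (allNames S₁) nc)))
  ncΔ : c ∉ b ∷ a ∷ names Θ
  ncΔ = ∉names-resp-↭ DK' (∉++⁻ʳ (allNames S₄) (∉++⁻ʳ (allNames S₃) (∉++⁻ʳ (allNames S₂) (∉++⁻ʳ (allNames S₁) nc))))
  cb : c ≢ b
  cb = ∉∷⁻ʰ ncΔ
  ca : c ≢ a
  ca = ∉∷⁻ʰ (∉∷⁻ᵗ ncΔ)

  E₁ = plus₁ c (dual D) (ax C c b)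
  E₂ = plus₂ c (dual C) (ax D c b)
  Eb = wth b E₁ E₂
  E₁⊢ : E₁ ⊢ (c , dual C ⊕ dual D) ∷ (b , C) ∷ []
  E₁⊢ = ⊢plus₁ (⊢ax cb)
  E₂⊢ : E₂ ⊢ (c , dual C ⊕ dual D) ∷ (b , D) ∷ []
  E₂⊢ = ⊢plus₂ (⊢ax cb)
  Eb⊢ : Eb ⊢ (c , dual C ⊕ dual D) ∷ (b , C & D) ∷ []
  Eb⊢ = ⊢-swap (⊢wth (⊢-swap E₁⊢) (⊢-swap E₂⊢))

  UZ : ∀ {X Y} → Unique (names (((a , X) ∷ Θ) ++ (b , Y) ∷ []))
  UZ {X} {Y} = Unique-names-resp-↭ (solve 3 (λ bY aX Θ → bY ∙ aX ∙ Θ ⊜ (aX ∙ Θ) ∙ bY) ↭-refl [ (b , Y) ] [ (a , X) ] Θ) UbaΘ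
  cutT : ∀ {W E X Y F} → W ⊢ (c , F) ∷ (a , X) ∷ Θ → E ⊢ (c , dual F) ∷ (b , Y) ∷ [] →
         cut F c W E ⊢ (b , Y) ∷ (a , X) ∷ Θ
  cutT {X = X} {Y} e f = ⊢ex (solve 3 (λ aX Θ bY → (aX ∙ Θ) ∙ bY ⊜ bY ∙ aX ∙ Θ) ↭-refl [ (a , X) ] Θ [ (b , Y) ])
                          (⊢cut e f (UZ {X} {Y}))

  wthaN : ∀ {n Z t u} → t ⊢ (n , Z) ∷ (a , A) ∷ Θ → u ⊢ (n , Z) ∷ (a , B) ∷ Θ → wth a t u ⊢ (n , Z) ∷ (a , A & B) ∷ Θ
  wthaN e f = ⊢-swap (⊢wth (⊢-swap e) (⊢-swap f))
  wthb : ∀ {t u} → t ⊢ (b , C) ∷ (a , A & B) ∷ Θ → u ⊢ (b , D) ∷ (a , A & B) ∷ Θ → wth b t u ⊢ Δ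
  wthb e f = ⊢ex DK' (⊢wth e f)
  PT : ∀ {t₁ t₂ t₃ t₄} → t₁ ⊢ (b , C) ∷ (a , A) ∷ Θ → t₂ ⊢ (b , D) ∷ (a , A) ∷ Θ →
       t₃ ⊢ (b , C) ∷ (a , B) ∷ Θ → t₄ ⊢ (b , D) ∷ (a , B) ∷ Θ → wth a (wth b t₁ t₂) (wth b t₃ t₄) ⊢ Δ
  PT e₁ e₂ e₃ e₄ = ⊢ex DK' (wthaN (⊢wth e₁ e₂) (⊢wth e₃ e₄))
  QT : ∀ {t₁ t₂ t₃ t₄} → t₁ ⊢ (b , C) ∷ (a , A) ∷ Θ → t₂ ⊢ (b , D) ∷ (a , A) ∷ Θ →
       t₃ ⊢ (b , C) ∷ (a , B) ∷ Θ → t₄ ⊢ (b , D) ∷ (a , B) ∷ Θ → wth b (wth a t₁ t₃) (wth a t₂ t₄) ⊢ Δ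
  QT e₁ e₂ e₃ e₄ = wthb (wthaN e₁ e₃) (wthaN e₂ e₄)

  cut-η₁ : ∀ {X S V} → S ⊢ (b , C) ∷ (a , X) ∷ Θ → b ∉ bound S → c ∉ allNames S → V ⊢ (c , D) ∷ (a , X) ∷ Θ →
         cut (C & D) c (wth c (ren b c S) V) E₁ ≈⟨ (b , C) ∷ (a , X) ∷ Θ ⟩ S
  cut-η₁ {S = S} dS nb ncS dV =
    β-step (cutT (⊢wth (⊢ren-head dS ncS) dV) E₁⊢) T'⊢ wth-plus₁ ▸
    β-step T'⊢ (subst (λ t → t ⊢ _) (sym (ren-inv S ncS)) dS) (ax-r₂ (∉allNames-ren-self S nb (≢-sym cb))) ▸
    ≈-reflexive (ren-inv S ncS)
    where T'⊢ = cutT (⊢ren-head dS ncS) (⊢ax cb)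
  cut-η₂ : ∀ {X S U} → S ⊢ (b , D) ∷ (a , X) ∷ Θ → b ∉ bound S → c ∉ allNames S → U ⊢ (c , C) ∷ (a , X) ∷ Θ →
         cut (C & D) c (wth c U (ren b c S)) E₂ ≈⟨ (b , D) ∷ (a , X) ∷ Θ ⟩ S
  cut-η₂ {S = S} dS nb ncS dU =
    β-step (cutT (⊢wth dU (⊢ren-head dS ncS)) E₂⊢) T'⊢ wth-plus₂ ▸
    β-step T'⊢ (subst (λ t → t ⊢ _) (sym (ren-inv S ncS)) dS) (ax-r₂ (∉allNames-ren-self S nb (≢-sym cb))) ▸
    ≈-reflexive (ren-inv S ncS)
    where T'⊢ = cutT (⊢ren-head dS ncS) (⊢ax cb)

  -- wth b S S' is recovered from its packing into c : C & D by cutting against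
  -- the η-expansion Eb of b : C & D.
  cut-η : ∀ {X S S'} → S ⊢ (b , C) ∷ (a , X) ∷ Θ → b ∉ bound S → c ∉ allNames S →
        S' ⊢ (b , D) ∷ (a , X) ∷ Θ → b ∉ bound S' → c ∉ allNames S' →
        cut (C & D) c (wth c (ren b c S) (ren b c S')) Eb ≈⟨ (b , C & D) ∷ (a , X) ∷ Θ ⟩ wth b S S'
  cut-η {S = S} {S'} dS nb ncS dS' nb' ncS' =
    β-step (cutT W⊢ Eb⊢) (⊢wth (cutT W⊢ E₁⊢) (cutT W⊢ E₂⊢)) (c-wthʳ (≢-sym cb)) ▸
    ≈-cong (λ t → wth b t (cut (C & D) c W E₂)) wthˡ (λ e → ⊢wth e (cutT W⊢ E₂⊢)) (cut-η₁ dS nb ncS (⊢ren-head dS' ncS')) ▸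
    ≈-cong (λ t → wth b S t) wthʳ (λ e → ⊢wth dS e) (cut-η₂ dS' nb' ncS' (⊢ren-head dS ncS))
    where
    W = wth c (ren b c S) (ren b c S')
    W⊢ = ⊢wth (⊢ren-head dS ncS) (⊢ren-head dS' ncS')

  ⊢S₁ = Freshened.⊢R̃ N1
  ⊢S₂ = Freshened.⊢R̃ N2
  ⊢S₃ = Freshened.⊢R̃ N3
  ⊢S₄ = Freshened.⊢R̃ N4
  nb1 = Freshened.R̃-avoids N1 (here refl)
  nb2 = Freshened.R̃-avoids N2 (here refl)
  nb3 = Freshened.R̃-avoids N3 (here refl)
  nb4 = Freshened.R̃-avoids N4 (here refl)
  W₁ = wth c (ren b c S₁) (ren b c S₂)
  W₂ = wth c (ren b c S₃) (ren b c S₄)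
  W₁⊢ = ⊢wth (⊢ren-head ⊢S₁ nc1) (⊢ren-head ⊢S₂ nc2)
  W₂⊢ = ⊢wth (⊢ren-head ⊢S₃ nc3) (⊢ren-head ⊢S₄ nc4)
  WW = wth a W₁ W₂
  WW⊢ : WW ⊢ (c , C & D) ∷ (a , A & B) ∷ Θ
  WW⊢ = wthaN W₁⊢ W₂⊢

  chP : wth a (wth b R₁ R₂) (wth b R₃ R₄) ≈⟨ Δ ⟩ wth a (wth b S₁ S₂) (wth b S₃ S₄)
  chP = ≈-cong (λ t → wth a (wth b t R₂) (wth b R₃ R₄)) (λ s → wthˡ (wthˡ s)) (λ e → PT e d2 d3 d4) (Freshened.R≈R̃ N1) ▸
        ≈-cong (λ t → wth a (wth b S₁ t) (wth b R₃ R₄)) (λ s → wthˡ (wthʳ s)) (λ e → PT ⊢S₁ e d3 d4) (Freshened.R≈R̃ N2) ▸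
        ≈-cong (λ t → wth a (wth b S₁ S₂) (wth b t R₄)) (λ s → wthʳ (wthˡ s)) (λ e → PT ⊢S₁ ⊢S₂ e d4) (Freshened.R≈R̃ N3) ▸
        ≈-cong (λ t → wth a (wth b S₁ S₂) (wth b S₃ t)) (λ s → wthʳ (wthʳ s)) (λ e → PT ⊢S₁ ⊢S₂ ⊢S₃ e) (Freshened.R≈R̃ N4)
  chQ : wth b (wth a R₁ R₃) (wth a R₂ R₄) ≈⟨ Δ ⟩ wth b (wth a S₁ S₃) (wth a S₂ S₄)
  chQ = ≈-cong (λ t → wth b (wth a t R₃) (wth a R₂ R₄)) (λ s → wthˡ (wthˡ s)) (λ e → QT e d2 d3 d4) (Freshened.R≈R̃ N1) ▸
        ≈-cong (λ t → wth b (wth a S₁ R₃) (wth a t R₄)) (λ s → wthʳ (wthˡ s)) (λ e → QT ⊢S₁ e d3 d4) (Freshened.R≈R̃ N2) ▸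
        ≈-cong (λ t → wth b (wth a S₁ t) (wth a S₂ R₄)) (λ s → wthˡ (wthʳ s)) (λ e → QT ⊢S₁ ⊢S₂ e d4) (Freshened.R≈R̃ N3) ▸
        ≈-cong (λ t → wth b (wth a S₁ S₃) (wth a S₂ t)) (λ s → wthʳ (wthʳ s)) (λ e → QT ⊢S₁ ⊢S₂ ⊢S₃ e) (Freshened.R≈R̃ N4)

  K⊢ : wth a (cut (C & D) c W₁ Eb) (cut (C & D) c W₂ Eb) ⊢ Δ
  K⊢ = ⊢ex DK' (wthaN (cutT W₁⊢ Eb⊢) (cutT W₂⊢ Eb⊢))
  chK : wth a (cut (C & D) c W₁ Eb) (cut (C & D) c W₂ Eb) ≈⟨ Δ ⟩ wth a (wth b S₁ S₂) (wth b S₃ S₄)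
  chK = ≈-cong (λ t → wth a t (cut (C & D) c W₂ Eb)) wthˡ (λ e → ⊢ex DK' (wthaN e (cutT W₂⊢ Eb⊢))) (cut-η ⊢S₁ nb1 nc1 ⊢S₂ nb2 nc2) ▸
        ≈-cong (λ t → wth a (wth b S₁ S₂) t) wthʳ (λ e → ⊢ex DK' (wthaN (⊢wth ⊢S₁ ⊢S₂) e)) (cut-η ⊢S₃ nb3 nc3 ⊢S₄ nb4 nc4)

  T⊢ : cut (C & D) c WW Eb ⊢ Δ
  T⊢ = ⊢ex DK' (cutT WW⊢ Eb⊢)
  N1⊢ : wth b (cut (C & D) c WW E₁) (cut (C & D) c WW E₂) ⊢ Δ
  N1⊢ = wthb (cutT WW⊢ E₁⊢) (cutT WW⊢ E₂⊢)
  N2⊢ : wth b (wth a (cut (C & D) c W₁ E₁) (cut (C & D) c W₂ E₁)) (cut (C & D) c WW E₂) ⊢ Δ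
  N2⊢ = wthb (wthaN (cutT W₁⊢ E₁⊢) (cutT W₂⊢ E₁⊢)) (cutT WW⊢ E₂⊢)
  N3⊢ : wth b (wth a S₁ S₃) (cut (C & D) c WW E₂) ⊢ Δ
  N3⊢ = wthb (wthaN ⊢S₁ ⊢S₃) (cutT WW⊢ E₂⊢)
  N4⊢ : wth b (wth a S₁ S₃) (wth a (cut (C & D) c W₁ E₂) (cut (C & D) c W₂ E₂)) ⊢ Δ
  N4⊢ = wthb (wthaN ⊢S₁ ⊢S₃) (wthaN (cutT W₁⊢ E₂⊢) (cutT W₂⊢ E₂⊢))

  chN2 : wth b (wth a (cut (C & D) c W₁ E₁) (cut (C & D) c W₂ E₁)) (cut (C & D) c WW E₂) ≈⟨ Δ ⟩
         wth b (wth a S₁ S₃) (cut (C & D) c WW E₂)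
  chN2 = ≈-cong (λ t → wth b (wth a t (cut (C & D) c W₂ E₁)) (cut (C & D) c WW E₂)) (λ s → wthˡ (wthˡ s))
            (λ e → wthb (wthaN e (cutT W₂⊢ E₁⊢)) (cutT WW⊢ E₂⊢)) (cut-η₁ ⊢S₁ nb1 nc1 (⊢ren-head ⊢S₂ nc2)) ▸
         ≈-cong (λ t → wth b (wth a S₁ t) (cut (C & D) c WW E₂)) (λ s → wthˡ (wthʳ s))
            (λ e → wthb (wthaN ⊢S₁ e) (cutT WW⊢ E₂⊢)) (cut-η₁ ⊢S₃ nb3 nc3 (⊢ren-head ⊢S₄ nc4))
  chN4 : wth b (wth a S₁ S₃) (wth a (cut (C & D) c W₁ E₂) (cut (C & D) c W₂ E₂)) ≈⟨ Δ ⟩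
         wth b (wth a S₁ S₃) (wth a S₂ S₄)
  chN4 = ≈-cong (λ t → wth b (wth a S₁ S₃) (wth a t (cut (C & D) c W₂ E₂))) (λ s → wthʳ (wthˡ s))
            (λ e → wthb (wthaN ⊢S₁ ⊢S₃) (wthaN e (cutT W₂⊢ E₂⊢))) (cut-η₂ ⊢S₂ nb2 nc2 (⊢ren-head ⊢S₁ nc1)) ▸
         ≈-cong (λ t → wth b (wth a S₁ S₃) (wth a S₂ t)) (λ s → wthʳ (wthʳ s))
            (λ e → wthb (wthaN ⊢S₁ ⊢S₃) (wthaN ⊢S₂ e)) (cut-η₂ ⊢S₄ nb4 nc4 (⊢ren-head ⊢S₃ nc3))

  -- Both orders are reducts of cut (wth a W₁ W₂) Eb: commuting the cut into the
  -- &-rule on a gives the left side, commuting it into the &-rule of Eb on b the right.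
  result : wth a (wth b R₁ R₂) (wth b R₃ R₄) ≈⟨ Δ ⟩ wth b (wth a R₁ R₃) (wth a R₂ R₄)
  result = chP ▸ ≈-sym chK ▸ ≈-sym (β-step T⊢ K⊢ (c-wthˡ (≢-sym ca))) ▸ β-step T⊢ N1⊢ (c-wthʳ (≢-sym cb)) ▸
           step N1⊢ N2⊢ (wthˡ (root (β-root (c-wthˡ (≢-sym ca))))) ▸ chN2 ▸
           step N3⊢ N4⊢ (wthʳ (root (β-root (c-wthˡ (≢-sym ca))))) ▸ chN4 ▸ ≈-sym chQ

comm-wth-wth : ∀ {a b R₁ R₂ R₃ R₄ Δ} → a ≢ b → CutFree (wth a (wth b R₁ R₂) (wth b R₃ R₄)) →
  wth a (wth b R₁ R₂) (wth b R₃ R₄) ⊢ Δ → wth a (wth b R₁ R₂) (wth b R₃ R₄) ≈⟨ Δ ⟩ wth b (wth a R₁ R₃) (wth a R₂ R₄)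
comm-wth-wth {a} {b} hab ((c1 , c2) , (c3 , c4)) dP with inv-wth dP
... | A , B , Γ₀ , dL , dR , q with inv-wth dL | inv-wth dR
... | C , D , Γ₁ , d1 , d2 , q1 | C' , D' , Γ₂ , d3 , d4 , q2
  with ↭-extract ((b , C & D) ∷ []) Γ₁ ((a , A) ∷ []) Γ₀ (Unique-names-resp-↭ (↭-sym q1) (⊢-Unique dL)) nb q1
     | ↭-extract ((b , C' & D') ∷ []) Γ₂ ((a , B) ∷ []) Γ₀ (Unique-names-resp-↭ (↭-sym q2) (⊢-Unique dR)) nb q2
  where
  nb : ∀ {z} → z ∈ a ∷ [] → z ∉ b ∷ []
  nb (here refl) (here e) = hab e
... | Θ₁ , r1 , r1' | Θ₂ , r2 , r2'
  with ↭-head⁻ (Unique-names-resp-↭ r2' (Unique-tail (Unique-names-resp-↭ (↭-sym q) (⊢-Unique dP)))) (trans (↭-sym r1') r2')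
... | refl , θ =
  WthWth.result hab c1 c2 c3 c4 (⊢ex (prep _ r1) d1) (⊢ex (prep _ r1) d2)
    (⊢ex (prep _ (trans r2 (prep _ (↭-sym θ)))) d3) (⊢ex (prep _ (trans r2 (prep _ (↭-sym θ)))) d4)
    (trans (prep _ (↭-sym r1')) q) (⊢-Unique dP)

RootComm⇒≈ : ∀ {P Q Δ} → RootComm P Q → CutFree P → CutFree Q → P ⊢ Δ → Q ⊢ Δ → P ≈⟨ Δ ⟩ Q
RootComm⇒≈ (lin-lin {F} {G} {R} h1 h2 h3 h4 h5) cP cQ dP dQ = comm-lin-lin F G h1 h2 h3 h4 h5 (CutFree-plug⁻ G (CutFree-plug⁻ F cP)) dP dQ
RootComm⇒≈ (lin-wth {H} h1 h2) cP cQ dP dQ = comm-lin-wth H h1 h2 cP dP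
RootComm⇒≈ (wth-wth hab) cP cQ dP dQ = comm-wth-wth hab cP dP
RootComm⇒≈ (lin-top {H} h) cP cQ dP dQ = comm-lin-top H h dP dQ
RootComm⇒≈ (wth-top hab) cP cQ dP dQ = comm-wth-top hab dP dQ
RootComm⇒≈ (top-top hab) cP cQ dP dQ = comm-top-top hab dP dQ

≡₁⇒≈ : ∀ {P Q Γ} → Cong Comm P Q → P ⊢ Γ → P ≈⟨ Γ ⟩ Q
≡₁⇒≈ {P} (root (comm dP dQ cP cQ (inj₁ rc))) d = ≈-resp-↭ (⊢-unique P dP d) (RootComm⇒≈ rc cP cQ dP dQ)
≡₁⇒≈ {P} (root (comm dP dQ cP cQ (inj₂ rc))) d = ≈-resp-↭ (⊢-unique P dP d) (≈-sym (RootComm⇒≈ rc cQ cP dQ dP))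
≡₁⇒≈ (cutˡ {A} {x} {P} {P'} {Q} s) d with inv-cut d
... | Γ₁ , Δ₁ , dP , dQ , u , q = ≈-cong (λ t → cut A x t Q) cutˡ (λ e → ⊢ex q (⊢cut e dQ u)) (≡₁⇒≈ s dP)
≡₁⇒≈ (cutʳ {A} {x} {P} {Q} {Q'} s) d with inv-cut d
... | Γ₁ , Δ₁ , dP , dQ , u , q = ≈-cong (λ t → cut A x P t) cutʳ (λ e → ⊢ex q (⊢cut dP e u)) (≡₁⇒≈ s dQ)
≡₁⇒≈ (tensˡ {x} {y} {P} {P'} {Q} s) d with inv-tens d
... | A , B , Γ₁ , Δ₁ , dP , dQ , u , q = ≈-cong (λ t → tens x y t Q) tensˡ (λ e → ⊢ex q (⊢tens e dQ u)) (≡₁⇒≈ s dP)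
≡₁⇒≈ (tensʳ {x} {y} {P} {Q} {Q'} s) d with inv-tens d
... | A , B , Γ₁ , Δ₁ , dP , dQ , u , q = ≈-cong (λ t → tens x y P t) tensʳ (λ e → ⊢ex q (⊢tens dP e u)) (≡₁⇒≈ s dQ)
≡₁⇒≈ (parᶜ {x} {y} s) d with inv-par d
... | A , B , Γ₁ , dP , q = ≈-cong (par x y) parᶜ (λ e → ⊢ex q (⊢par e)) (≡₁⇒≈ s dP)
≡₁⇒≈ (botᶜ {x} s) d with inv-bot d
... | Γ₁ , dP , n , q = ≈-cong (bot x) botᶜ (λ e → ⊢ex q (⊢bot e n)) (≡₁⇒≈ s dP)
≡₁⇒≈ (wthˡ {x} {P} {P'} {Q} s) d with inv-wth d
... | A , B , Γ₁ , dP , dQ , q = ≈-cong (λ t → wth x t Q) wthˡ (λ e → ⊢ex q (⊢wth e dQ)) (≡₁⇒≈ s dP)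
≡₁⇒≈ (wthʳ {x} {P} {Q} {Q'} s) d with inv-wth d
... | A , B , Γ₁ , dP , dQ , q = ≈-cong (λ t → wth x P t) wthʳ (λ e → ⊢ex q (⊢wth dP e)) (≡₁⇒≈ s dQ)
≡₁⇒≈ (plus₁ᶜ {x} {B} s) d with inv-plus₁ d
... | A , Γ₁ , dP , q = ≈-cong (plus₁ x B) plus₁ᶜ (λ e → ⊢ex q (⊢plus₁ e)) (≡₁⇒≈ s dP)
≡₁⇒≈ (plus₂ᶜ {x} {A} s) d with inv-plus₂ d
... | B , Γ₁ , dP , q = ≈-cong (plus₂ x A) plus₂ᶜ (λ e → ⊢ex q (⊢plus₂ e)) (≡₁⇒≈ s dP)

proposition4p1 : ∀ {π τ : Term} {Γ : Sequent} → π ⊢ Γ → τ ⊢ Γ → π ≡₁ τ → π =β τ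
proposition4p1 dπ dτ c = ≈⇒=β (≡₁⇒≈ c dπ)
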